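{- For all integers $d\ge1$: $P_{d,2}=\frac12 d^2+\frac32 d$ and $P_{d,3}=\frac16 d^3+d^2+\frac{17}{6}d-2$.
   Context: $[n]=\{1,\dots,n\}$. For $0\le d<n$, a $d$-co-signotope on $n$ elements is a map $\tau:\binom{[n]}{d}\to\{+,-\}$ such that for every $d$-subset $B=\{b_1<\dots<b_d\}$ and every $j\in[d]$, writing $B_j=B\setminus\{b_j\}$ and $[n]\setminus B_j=\{x_1<\dots<x_{n-d+1}\}$, the sequence $(\tau(B_j\cup\{x_1\}),\dots,\tau(B_j\cup\{x_{n-d+1}\}))$ has at most one sign change. $\bar{\mathcal{S}}_p(n,d)$ is the set of $d$-co-signotopes on $n$ elements with exactly $p$ subsets mapped to $+$. For $d\ge1$, $p\ge0$, the plus count $P_{d,p}$ is $|\bar{\mathcal{S}}_p(n,d)|$ for any $n\ge p+d$ (this number does not depend on the choice of $n\ge p+d$). -}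

module Defs where

open import Data.Bool using (Bool; true; false; _∧_; _∨_; not; _xor_; if_then_else_)
open import Data.Nat using (ℕ; zero; suc; _+_; _≤ᵇ_)
open import Data.Fin using (Fin)
open import Data.List using (List; []; _∷_; [_]; map; _++_; length; filterᵇ; allFin)
open import Data.Bool.ListAction using (all; any)
open import Data.Vec using (Vec; []; _∷_; lookup; _[_]≔_)
open import Data.Fin.Subset using (Subset)

-- Subsets of [n] are characteristic vectors 'Subset n = Vec Bool n'
-- (true = element present); position i : Fin n stands for element i+1,
-- so the natural order on Fin n is the order on [n].

eqS : ∀ {n} → Subset n → Subset n → Bool
eqS [] [] = true
eqS (a ∷ s) (b ∷ t) = (if a then b else not b) ∧ eqS s t

subsets : (n d : ℕ) → List (Subset n)
subsets zero zero = [ [] ]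
subsets zero (suc d) = []
subsets (suc n) zero = map (false ∷_) (subsets n zero)
subsets (suc n) (suc d) =
  map (false ∷_) (subsets n (suc d)) ++ map (true ∷_) (subsets n d)

choose : ∀ {A : Set} → ℕ → List A → List (List A)
choose zero xs = [ [] ]
choose (suc k) [] = []
choose (suc k) (x ∷ xs) = map (x ∷_) (choose k xs) ++ choose (suc k) xs

-- A sign map τ : binom([n],d) → {+,-} is encoded by its set of plus
-- subsets F (a sublist of 'subsets n d'): τ(S) = + iff S ∈ F.
τ : ∀ {n} → List (Subset n) → Subset n → Bool
τ F S = any (eqS S) F

signChanges : List Bool → ℕ
signChanges (a ∷ b ∷ rest) = (if a xor b then 1 else 0) + signChanges (b ∷ rest)
signChanges _ = 0

-- For a d-subset B and an element b_j = i of B, with B_j = B \ {b_j}: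
-- the sequence (τ(B_j ∪ {x_1}), …, τ(B_j ∪ {x_{n-d+1}})) where
-- x_1 < … are the elements of [n] \ B_j in increasing order.
signSeq : ∀ {n} → List (Subset n) → Subset n → Fin n → List Bool
signSeq {n} F B i =
  map (λ x → τ F (Bj [ x ]≔ true)) (filterᵇ (λ x → not (lookup Bj x)) (allFin n))
  where
  Bj = B [ i ]≔ false

isCoSignotope : (n d : ℕ) → List (Subset n) → Bool
isCoSignotope n d F =
  all (λ B → all (λ i → not (lookup B i) ∨ (signChanges (signSeq F B i) ≤ᵇ 1))
                 (allFin n))
      (subsets n d)

coSigCount : (n d p : ℕ) → ℕ
coSigCount n d p = length (filterᵇ (isCoSignotope n d) (choose p (subsets n d)))

module Submission where

-- Split a family F of d-subsets of [n+1] at the element 1 into its deletion (the members avoiding 1) and its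
-- link (the members containing 1, with 1 removed). The line through a (d-1)-set C ∋ 1 is a line of the link;
-- the line through C ∌ 1 first reads τ(C ∪ {1}), which the link decides, and then runs on as a line of the
-- deletion. Recording on every line the phase of the automaton that accepts at most one sign change turns
-- validity into a recursion on n. Writing P(n, d, p) for the number of valid p-families of d-subsets of [n] and
-- sorting the families by the size of their link gives, for n large,
--   P(n+1, d+1, 2) = 1 + (d+1) + P(n, d, 2),
--   P(n+1, d+1, 3) = (1 + min(1, d)) + (d+1) + [d ≥ 1] (d + 2 + P(n-1, d-1, 2)) + P(n, d, 3).
-- With an empty link every line of the deletion has already read a minus, so its plus signs form a final
-- segment; this pins the family to the sets at the top of [n] and makes the empty-link terms 1 and 1 + min(1, d).
-- Solving the recurrences from P(n, 0, p) = 0 (p ≥ 2) gives the closed forms.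

open import Defs

open import Data.Bool using (Bool; true; false; _∧_; _∨_; not; if_then_else_; T)
open import Data.Bool.ListAction using (all)
open import Data.Bool.Properties using (∨-identityʳ; ∧-identityʳ)
open import Data.Empty using (⊥-elim)
open import Data.Fin using (Fin; zero; suc)
open import Data.Fin.Subset using (Subset)
open import Data.List using (List; []; _∷_; [_]; map; _++_; length; filterᵇ; allFin)
open import Data.List.Membership.Propositional using (_∈_)
open import Data.List.Membership.Propositional.Properties
  using (∈-++⁻; ∈-map⁻; ∈-map⁺; ∈-++⁺ˡ; ∈-++⁺ʳ; ∈-filter⁻; ∈-filter⁺; ∈-allFin)
open import Data.List.Properties using (map-++; map-∘; map-cong; map-tabulate; length-map; ++-identityʳ)
import Data.List.Relation.Unary.All as All
open import Data.List.Relation.Unary.AllPairs using ([]; _∷_)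
open import Data.List.Relation.Unary.Any using (here; there)
open import Data.List.Relation.Unary.Unique.Propositional using (Unique)
open import Data.List.Relation.Unary.Unique.Propositional.Properties using (map⁺; ++⁺)
open import Data.Nat using (ℕ; zero; suc; pred; z<s; _+_; _*_; _^_; _∸_; _⊓_; _≤_; _<_; s≤s; z≤n; _≡ᵇ_; _≤ᵇ_; _≟_; _≤?_)
open import Data.Nat.Properties
  using ( +-assoc; +-comm; +-identityʳ; +-suc; +-cancelʳ-≡; +-mono-≤; +-monoʳ-≤; suc-injective
        ; ≤-refl; ≤-reflexive; ≤-trans; ≤-antisym; ≤-pred; n≤1+n; m≤n+m; m≤n⇒m≤1+n; n≤0⇒n≡0
        ; <-irrefl; <⇒≢; ≤-<-trans; m<m+n; ≤∧≢⇒<; ≮⇒≥; ≤⇒≤ᵇ; ≡ᵇ⇒≡; m+n∸n≡m; m+n≤o⇒m≤o∸n; m<n⇒0<n∸m)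
open import Data.Nat.Solver using (module +-*-Solver)
open import Data.Product using (Σ; ∃; _×_; _,_; proj₁; proj₂)
open import Data.Sum using (_⊎_; inj₁; inj₂)
open import Data.Vec using ([]; _∷_; lookup; _[_]≔_)
open import Data.Vec.Properties using (∷-injectiveʳ)
open import Function using (_∘_; id)
open import Relation.Binary.PropositionalEquality using (_≡_; _≢_; refl; sym; trans; cong; cong₂; subst; module ≡-Reasoning)
open import Relation.Nullary using (¬_; yes; no)
open import Relation.Nullary.Decidable.Core using (T?)

open +-*-Solver using (solve; _:+_; _:*_; _:^_; _:=_; con)

private variable A B : Set

-- Sums over sublists

∑ : List A → (A → ℕ) → ℕ
∑ [] f = 0
∑ (x ∷ xs) f = f x + ∑ xs f

when : Bool → ℕ → ℕ
when true x = x
when false _ = 0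

sublists : List A → List (List A)
sublists [] = [ [] ]
sublists (x ∷ xs) = map (x ∷_) (sublists xs) ++ sublists xs

∑-++ : ∀ (xs ys : List A) f → ∑ (xs ++ ys) f ≡ ∑ xs f + ∑ ys f
∑-++ [] ys f = refl
∑-++ (x ∷ xs) ys f = trans (cong (f x +_) (∑-++ xs ys f)) (sym (+-assoc (f x) _ _))

∑-map : ∀ (g : A → B) xs f → ∑ (map g xs) f ≡ ∑ xs (f ∘ g)
∑-map g [] f = refl
∑-map g (x ∷ xs) f = cong (f (g x) +_) (∑-map g xs f)

∑-cong : ∀ {f g : A → ℕ} → (∀ x → f x ≡ g x) → ∀ xs → ∑ xs f ≡ ∑ xs g
∑-cong e [] = refl
∑-cong e (x ∷ xs) = cong₂ _+_ (e x) (∑-cong e xs)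

∑-cong-∈ : ∀ {f g : A → ℕ} xs → (∀ x → x ∈ xs → f x ≡ g x) → ∑ xs f ≡ ∑ xs g
∑-cong-∈ [] e = refl
∑-cong-∈ (x ∷ xs) e = cong₂ _+_ (e x (here refl)) (∑-cong-∈ xs (λ y p → e y (there p)))

∑-zero : ∀ {f : A → ℕ} xs → (∀ x → x ∈ xs → f x ≡ 0) → ∑ xs f ≡ 0
∑-zero [] e = refl
∑-zero (x ∷ xs) e = cong₂ _+_ (e x (here refl)) (∑-zero xs (λ y p → e y (there p)))

∑-+ : ∀ (xs : List A) f g → ∑ xs (λ x → f x + g x) ≡ ∑ xs f + ∑ xs g
∑-+ [] f g = refl
∑-+ (x ∷ xs) f g = begin
  (f x + g x) + ∑ xs (λ x → f x + g x) ≡⟨ cong ((f x + g x) +_) (∑-+ xs f g) ⟩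
  (f x + g x) + (∑ xs f + ∑ xs g)       ≡⟨ +-assoc (f x) (g x) _ ⟩
  f x + (g x + (∑ xs f + ∑ xs g))       ≡⟨ cong (f x +_) (sym (+-assoc (g x) _ _)) ⟩
  f x + ((g x + ∑ xs f) + ∑ xs g)       ≡⟨ cong (λ t → f x + (t + ∑ xs g)) (+-comm (g x) _) ⟩
  f x + ((∑ xs f + g x) + ∑ xs g)       ≡⟨ cong (f x +_) (+-assoc (∑ xs f) _ _) ⟩
  f x + (∑ xs f + (g x + ∑ xs g))       ≡⟨ sym (+-assoc (f x) _ _) ⟩
  (f x + ∑ xs f) + (g x + ∑ xs g)       ∎
  where open ≡-Reasoning

∑-comm : ∀ (xs : List A) (ys : List B) (h : A → B → ℕ) → ∑ xs (λ a → ∑ ys (h a)) ≡ ∑ ys (λ b → ∑ xs (λ a → h a b))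
∑-comm [] ys h = sym (∑-zero ys (λ _ _ → refl))
∑-comm (x ∷ xs) ys h = trans (cong (∑ ys (h x) +_) (∑-comm xs ys h))
                             (sym (∑-+ ys (h x) (λ b → ∑ xs (λ a → h a b))))

∑-when : ∀ c (xs : List A) f → ∑ xs (λ a → when c (f a)) ≡ when c (∑ xs f)
∑-when true xs f = refl
∑-when false xs f = ∑-zero xs (λ _ _ → refl)

when-zero : ∀ c → when c 0 ≡ 0
when-zero true = refl
when-zero false = refl

when-∧ : ∀ a b x → when (a ∧ b) x ≡ when b (when a x)
when-∧ true b x = refl
when-∧ false true x = refl
when-∧ false false x = refl

when-comm : ∀ a b x → when a (when b x) ≡ when b (when a x)
when-comm true b x = refl
when-comm false true x = refl
when-comm false false x = refl

length-filterᵇ : ∀ (P : A → Bool) xs → length (filterᵇ P xs) ≡ ∑ xs (λ a → when (P a) 1)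
length-filterᵇ P [] = refl
length-filterᵇ P (x ∷ xs) with P x
... | true = cong suc (length-filterᵇ P xs)
... | false = length-filterᵇ P xs

∑-sublists-++ : ∀ (xs ys : List A) h →
  ∑ (sublists (xs ++ ys)) h ≡ ∑ (sublists xs) (λ a → ∑ (sublists ys) (λ b → h (a ++ b)))
∑-sublists-++ [] ys h = sym (+-identityʳ _)
∑-sublists-++ (x ∷ xs) ys h = begin
  ∑ (map (x ∷_) (sublists (xs ++ ys)) ++ sublists (xs ++ ys)) h
    ≡⟨ ∑-++ (map (x ∷_) (sublists (xs ++ ys))) _ h ⟩
  ∑ (map (x ∷_) (sublists (xs ++ ys))) h + ∑ (sublists (xs ++ ys)) h
    ≡⟨ cong₂ _+_ (trans (∑-map (x ∷_) (sublists (xs ++ ys)) h) (∑-sublists-++ xs ys (h ∘ (x ∷_)))) (∑-sublists-++ xs ys h) ⟩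
  ∑ (sublists xs) (λ a → ∑ (sublists ys) (λ b → h (x ∷ a ++ b))) + ∑ (sublists xs) (λ a → ∑ (sublists ys) (λ b → h (a ++ b)))
    ≡⟨ cong (_+ _) (sym (∑-map (x ∷_) (sublists xs) _)) ⟩
  ∑ (map (x ∷_) (sublists xs)) (λ a → ∑ (sublists ys) (λ b → h (a ++ b))) + ∑ (sublists xs) (λ a → ∑ (sublists ys) (λ b → h (a ++ b)))
    ≡⟨ sym (∑-++ (map (x ∷_) (sublists xs)) _ _) ⟩
  ∑ (sublists (x ∷ xs)) (λ a → ∑ (sublists ys) (λ b → h (a ++ b))) ∎
  where open ≡-Reasoning

sublists-map : ∀ (f : A → B) xs → sublists (map f xs) ≡ map (map f) (sublists xs)
sublists-map f [] = refl
sublists-map f (x ∷ xs) = begin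
  map (f x ∷_) (sublists (map f xs)) ++ sublists (map f xs)
    ≡⟨ cong (λ s → map (f x ∷_) s ++ s) (sublists-map f xs) ⟩
  map (f x ∷_) (map (map f) (sublists xs)) ++ map (map f) (sublists xs)
    ≡⟨ cong (_++ _) (trans (sym (map-∘ (sublists xs))) (map-∘ (sublists xs))) ⟩
  map (map f) (map (x ∷_) (sublists xs)) ++ map (map f) (sublists xs)
    ≡⟨ sym (map-++ (map f) (map (x ∷_) (sublists xs)) _) ⟩
  map (map f) (sublists (x ∷ xs)) ∎
  where open ≡-Reasoning

∈-sublists⇒⊆ : ∀ {L : List A} {b x} → b ∈ sublists L → x ∈ b → x ∈ L
∈-sublists⇒⊆ {L = []} (here refl) ()
∈-sublists⇒⊆ {L = y ∷ L} p q with ∈-++⁻ (map (y ∷_) (sublists L)) p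
... | inj₂ p′ = there (∈-sublists⇒⊆ p′ q)
... | inj₁ p′ with ∈-map⁻ (y ∷_) p′ | q
...   | _ , _ , refl | here refl = here refl
...   | _ , p″ , refl | there q′ = there (∈-sublists⇒⊆ p″ q′)

∑-sublists-[] : ∀ (L : List A) f → (∀ x b → x ∈ L → f (x ∷ b) ≡ 0) → ∑ (sublists L) f ≡ f []
∑-sublists-[] [] f h = +-identityʳ _
∑-sublists-[] (y ∷ L) f h = begin
  ∑ (map (y ∷_) (sublists L) ++ sublists L) f       ≡⟨ ∑-++ (map (y ∷_) (sublists L)) _ f ⟩
  ∑ (map (y ∷_) (sublists L)) f + ∑ (sublists L) f  ≡⟨ cong₂ _+_ (trans (∑-map (y ∷_) (sublists L) f) (∑-zero (sublists L) (λ b _ → h y b (here refl))))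
                                                                  (∑-sublists-[] L f (λ x b p → h x b (there p))) ⟩
  f [] ∎
  where open ≡-Reasoning

∑-sublists-≤1 : ∀ (L : List A) f → (∀ x y b → x ∈ L → f (x ∷ y ∷ b) ≡ 0) →
  ∑ (sublists L) f ≡ f [] + ∑ L (f ∘ [_])
∑-sublists-≤1 [] f h = refl
∑-sublists-≤1 (z ∷ L) f h = begin
  ∑ (map (z ∷_) (sublists L) ++ sublists L) f              ≡⟨ ∑-++ (map (z ∷_) (sublists L)) _ f ⟩
  ∑ (map (z ∷_) (sublists L)) f + ∑ (sublists L) f         ≡⟨ cong₂ _+_ (trans (∑-map (z ∷_) (sublists L) f) (∑-sublists-[] L (f ∘ (z ∷_)) (λ y b _ → h z y b (here refl))))
                                                                        (∑-sublists-≤1 L f (λ x y b p → h x y b (there p))) ⟩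
  f [ z ] + (f [] + ∑ L (f ∘ [_]))                         ≡⟨ sym (+-assoc (f [ z ]) _ _) ⟩
  (f [ z ] + f []) + ∑ L (f ∘ [_])                         ≡⟨ cong (_+ ∑ L (f ∘ [_])) (+-comm (f [ z ]) _) ⟩
  (f [] + f [ z ]) + ∑ L (f ∘ [_])                         ≡⟨ +-assoc (f []) _ _ ⟩
  f [] + ∑ (z ∷ L) (f ∘ [_]) ∎
  where open ≡-Reasoning

∑-sublists-length0 : ∀ (L : List A) (f : List A → ℕ) → ∑ (sublists L) (λ b → when (length b ≡ᵇ 0) (f b)) ≡ f []
∑-sublists-length0 L f = ∑-sublists-[] L (λ b → when (length b ≡ᵇ 0) (f b)) (λ _ _ _ → refl)

∑-sublists-length1 : ∀ (L : List A) (f : List A → ℕ) → ∑ (sublists L) (λ b → when (length b ≡ᵇ 1) (f b)) ≡ ∑ L (f ∘ [_])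
∑-sublists-length1 L f = ∑-sublists-≤1 L (λ b → when (length b ≡ᵇ 1) (f b)) (λ _ _ _ _ → refl)

∑-unique-support : ∀ {L : List A} {k} g → Unique L → k ∈ L →
  (∀ x → x ∈ L → x ≢ k → g x ≡ 0) → ∑ L g ≡ g k
∑-unique-support {L = x ∷ L} g (x∉L ∷ u) (here refl) h =
  trans (cong (g x +_) (∑-zero L (λ y p → h y (there p) (λ y≡x → All.lookup x∉L p (sym y≡x))))) (+-identityʳ _)
∑-unique-support {L = x ∷ L} {k} g (x∉L ∷ u) (there k∈L) h =
  trans (cong (_+ ∑ L g) (h x (here refl) (All.lookup x∉L k∈L))) (∑-unique-support g u k∈L (λ y p → h y (there p)))

∑-sublists-unique-support : ∀ {L : List A} {k} f → Unique L → k ∈ L →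
  (∀ x b → x ∈ L → x ≢ k → f (x ∷ b) ≡ 0) →
  (∀ y b → y ∈ L → y ≢ k → f (k ∷ y ∷ b) ≡ 0) →
  ∑ (sublists L) f ≡ f [] + f [ k ]
∑-sublists-unique-support {L = x ∷ L} f (x∉L ∷ u) (here refl) h₁ h₂ = begin
  ∑ (map (x ∷_) (sublists L) ++ sublists L) f       ≡⟨ ∑-++ (map (x ∷_) (sublists L)) _ f ⟩
  ∑ (map (x ∷_) (sublists L)) f + ∑ (sublists L) f  ≡⟨ cong₂ _+_ (trans (∑-map (x ∷_) (sublists L) f) (∑-sublists-[] L (f ∘ (x ∷_)) (λ y b p → h₂ y b (there p) (≢x p))))
                                                                  (∑-sublists-[] L f (λ y b p → h₁ y b (there p) (≢x p))) ⟩
  f [ x ] + f []                                     ≡⟨ +-comm (f [ x ]) _ ⟩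
  f [] + f [ x ] ∎
  where
  open ≡-Reasoning
  ≢x : ∀ {y} → y ∈ L → y ≢ x
  ≢x p y≡x = All.lookup x∉L p (sym y≡x)
∑-sublists-unique-support {L = x ∷ L} f (x∉L ∷ u) (there k∈L) h₁ h₂ = begin
  ∑ (map (x ∷_) (sublists L) ++ sublists L) f       ≡⟨ ∑-++ (map (x ∷_) (sublists L)) _ f ⟩
  ∑ (map (x ∷_) (sublists L)) f + ∑ (sublists L) f  ≡⟨ cong₂ _+_ (trans (∑-map (x ∷_) (sublists L) f) (∑-zero (sublists L) (λ b _ → h₁ x b (here refl) (All.lookup x∉L k∈L))))
                                                                  (∑-sublists-unique-support f u k∈L (λ y b p → h₁ y b (there p)) (λ y b p → h₂ y b (there p))) ⟩
  _ ∎
  where open ≡-Reasoning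

-- Lines and valid families

deletion : ∀ {n} → List (Subset (suc n)) → List (Subset n)
deletion [] = []
deletion ((false ∷ S) ∷ F) = S ∷ deletion F
deletion ((true ∷ S) ∷ F) = deletion F

link : ∀ {n} → List (Subset (suc n)) → List (Subset n)
link [] = []
link ((false ∷ S) ∷ F) = link F
link ((true ∷ S) ∷ F) = S ∷ link F

τ-deletion : ∀ {n} (F : List (Subset (suc n))) S → τ F (false ∷ S) ≡ τ (deletion F) S
τ-deletion [] S = refl
τ-deletion ((false ∷ T) ∷ F) S = cong (eqS S T ∨_) (τ-deletion F S)
τ-deletion ((true ∷ T) ∷ F) S = τ-deletion F S

τ-link : ∀ {n} (F : List (Subset (suc n))) S → τ F (true ∷ S) ≡ τ (link F) S
τ-link [] S = refl
τ-link ((false ∷ T) ∷ F) S = τ-link F S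
τ-link ((true ∷ T) ∷ F) S = cong (eqS S T ∨_) (τ-link F S)

without1 : ∀ {n} → List (Subset n) → List (Subset (suc n))
without1 = map (false ∷_)

with1 : ∀ {n} → List (Subset n) → List (Subset (suc n))
with1 = map (true ∷_)

deletion-split : ∀ {n} (a b : List (Subset n)) → deletion (without1 a ++ with1 b) ≡ a
deletion-split (x ∷ a) b = cong (x ∷_) (deletion-split a b)
deletion-split [] [] = refl
deletion-split [] (x ∷ b) = deletion-split [] b

link-split : ∀ {n} (a b : List (Subset n)) → link (without1 a ++ with1 b) ≡ b
link-split (x ∷ a) b = link-split a b
link-split [] [] = refl
link-split [] (x ∷ b) = cong (x ∷_) (link-split [] b)

gaps : ∀ {n} → Subset n → List (Fin n)
gaps {n} C = filterᵇ (λ x → not (lookup C x)) (allFin n)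

line : ∀ {n} → List (Subset n) → Subset n → List Bool
line F C = map (λ x → τ F (C [ x ]≔ true)) (gaps C)

filterᵇ-map-suc : ∀ {n} (p : Fin (suc n) → Bool) (xs : List (Fin n)) →
  filterᵇ p (map suc xs) ≡ map suc (filterᵇ (p ∘ suc) xs)
filterᵇ-map-suc p [] = refl
filterᵇ-map-suc p (x ∷ xs) with p (suc x)
... | true = cong (suc x ∷_) (filterᵇ-map-suc p xs)
... | false = filterᵇ-map-suc p xs

allFin-suc : ∀ n → allFin (suc n) ≡ zero ∷ map suc (allFin n)
allFin-suc n = cong (zero ∷_) (sym (map-tabulate id suc))

gaps-false∷ : ∀ {n} (C : Subset n) → gaps (false ∷ C) ≡ zero ∷ map suc (gaps C)
gaps-false∷ {n} C = trans (cong (filterᵇ (λ x → not (lookup (false ∷ C) x))) (allFin-suc n))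
                           (cong (zero ∷_) (filterᵇ-map-suc (λ x → not (lookup (false ∷ C) x)) (allFin n)))

gaps-true∷ : ∀ {n} (C : Subset n) → gaps (true ∷ C) ≡ map suc (gaps C)
gaps-true∷ {n} C = trans (cong (filterᵇ (λ x → not (lookup (true ∷ C) x))) (allFin-suc n))
                          (filterᵇ-map-suc (λ x → not (lookup (true ∷ C) x)) (allFin n))

line-false∷ : ∀ {n} (F : List (Subset (suc n))) C →
  line F (false ∷ C) ≡ τ (link F) C ∷ line (deletion F) C
line-false∷ F C = trans (cong (map (λ x → τ F ((false ∷ C) [ x ]≔ true))) (gaps-false∷ C))
  (cong₂ _∷_ (τ-link F C) (trans (sym (map-∘ (gaps C))) (map-cong (λ x → τ-deletion F (C [ x ]≔ true)) (gaps C))))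

line-true∷ : ∀ {n} (F : List (Subset (suc n))) C → line F (true ∷ C) ≡ line (link F) C
line-true∷ F C = trans (cong (map (λ x → τ F ((true ∷ C) [ x ]≔ true))) (gaps-true∷ C))
  (trans (sym (map-∘ (gaps C))) (map-cong (λ x → τ-link F (C [ x ]≔ true)) (gaps C)))

-- A line is read by an automaton accepting the sign sequences with at most one sign change.
data Phase : Set where
  start neg pos negPos posNeg dead : Phase

step : Phase → Bool → Phase
step start b = if b then pos else neg
step neg false = neg
step neg true = negPos
step pos false = posNeg
step pos true = pos
step negPos false = dead
step negPos true = negPos
step posNeg false = posNeg
step posNeg true = dead
step dead _ = dead

run : Phase → List Bool → Phase
run s [] = s
run s (b ∷ l) = run (step s b) l

alive : Phase → Bool
alive dead = false
alive _ = true

accepts : Phase → List Bool → Bool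
accepts s l = alive (run s l)

everySubset : (n : ℕ) → List (Subset n)
everySubset zero = [ [] ]
everySubset (suc n) = without1 (everySubset n) ++ with1 (everySubset n)

-- σ C is the phase in which the line through C starts, i.e. what it has read outside the current ground set.
valid : (n : ℕ) → (Subset n → Phase) → List (Subset n) → Bool
valid n σ F = all (λ C → accepts (σ C) (line F C)) (everySubset n)

fresh : ∀ {n} → Subset n → Phase
fresh _ = start

deletionEnv : ∀ {n} → (Subset (suc n) → Phase) → List (Subset n) → Subset n → Phase
deletionEnv σ b C = step (σ (false ∷ C)) (τ b C)

linkEnv : ∀ {n} → (Subset (suc n) → Phase) → Subset n → Phase
linkEnv σ C = σ (true ∷ C)

all-++ : ∀ {A : Set} (p : A → Bool) xs ys → all p (xs ++ ys) ≡ (all p xs ∧ all p ys)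
all-++ p [] ys = refl
all-++ p (x ∷ xs) ys with p x
... | true = all-++ p xs ys
... | false = refl

all-map : ∀ {A B : Set} (p : B → Bool) (f : A → B) xs → all p (map f xs) ≡ all (p ∘ f) xs
all-map p f [] = refl
all-map p f (x ∷ xs) = cong (p (f x) ∧_) (all-map p f xs)

all-cong : ∀ {A : Set} {p q : A → Bool} → (∀ x → p x ≡ q x) → ∀ xs → all p xs ≡ all q xs
all-cong e [] = refl
all-cong e (x ∷ xs) = cong₂ _∧_ (e x) (all-cong e xs)

all-elim : ∀ {A : Set} (p : A → Bool) {xs} → all p xs ≡ true → ∀ {x} → x ∈ xs → p x ≡ true
all-elim p {y ∷ xs} e (here refl) with p y | e
... | true | _ = refl
all-elim p {y ∷ xs} e (there q) with p y | e
... | true | e′ = all-elim p e′ q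

all-intro : ∀ {A : Set} (p : A → Bool) xs → (∀ x → x ∈ xs → p x ≡ true) → all p xs ≡ true
all-intro p [] h = refl
all-intro p (y ∷ xs) h rewrite h y (here refl) = all-intro p xs (λ x q → h x (there q))

∈-everySubset : ∀ {n} (C : Subset n) → C ∈ everySubset n
∈-everySubset [] = here refl
∈-everySubset {suc n} (false ∷ C) = ∈-++⁺ˡ (∈-map⁺ (false ∷_) (∈-everySubset C))
∈-everySubset {suc n} (true ∷ C) = ∈-++⁺ʳ (without1 (everySubset n)) (∈-map⁺ (true ∷_) (∈-everySubset C))

valid-suc : ∀ n (σ : Subset (suc n) → Phase) F →
  valid (suc n) σ F ≡ (valid n (deletionEnv σ (link F)) (deletion F) ∧ valid n (linkEnv σ) (link F))
valid-suc n σ F =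
  trans (all-++ (λ C → accepts (σ C) (line F C)) (without1 (everySubset n)) (with1 (everySubset n)))
  (cong₂ _∧_
    (trans (all-map (λ C → accepts (σ C) (line F C)) (false ∷_) (everySubset n))
           (all-cong (λ C → cong (accepts (σ (false ∷ C))) (line-false∷ F C)) (everySubset n)))
    (trans (all-map (λ C → accepts (σ C) (line F C)) (true ∷_) (everySubset n))
           (all-cong (λ C → cong (accepts (σ (true ∷ C))) (line-true∷ F C)) (everySubset n))))

valid-split : ∀ n (σ : Subset (suc n) → Phase) a b →
  valid (suc n) σ (without1 a ++ with1 b) ≡ (valid n (deletionEnv σ b) a ∧ valid n (linkEnv σ) b)
valid-split n σ a b rewrite valid-suc n σ (without1 a ++ with1 b) | deletion-split a b | link-split a b = refl

valid-cong-env : ∀ n {σ σ′ : Subset n → Phase} F → (∀ C → σ C ≡ σ′ C) → valid n σ F ≡ valid n σ′ F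
valid-cong-env n F e = all-cong (λ C → cong (λ s → accepts s (line F C)) (e C)) (everySubset n)

∑valid : (n W : ℕ) → (Subset n → Phase) → (List (Subset n) → ℕ) → ℕ
∑valid n W σ h = ∑ (sublists (subsets n W)) (λ A → when (valid n σ A) (h A))

∑valid-suc : ∀ n W σ h → ∑valid (suc n) (suc W) σ h ≡
  ∑ (sublists (subsets n W)) (λ b → when (valid n (linkEnv σ) b)
     (∑valid n (suc W) (deletionEnv σ b) (λ a → h (without1 a ++ with1 b))))
∑valid-suc n W σ h = begin
  ∑ (sublists (without1 (subsets n (suc W)) ++ with1 (subsets n W))) (λ A → when (valid (suc n) σ A) (h A))
    ≡⟨ ∑-sublists-++ (without1 (subsets n (suc W))) (with1 (subsets n W)) _ ⟩
  ∑ (sublists (without1 (subsets n (suc W)))) (λ a → ∑ (sublists (with1 (subsets n W))) (λ b → H (a ++ b)))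
    ≡⟨ cong (λ s → ∑ s (λ a → ∑ (sublists (with1 (subsets n W))) (λ b → H (a ++ b)))) (sublists-map (false ∷_) (subsets n (suc W))) ⟩
  ∑ (map without1 (sublists (subsets n (suc W)))) (λ a → ∑ (sublists (with1 (subsets n W))) (λ b → H (a ++ b)))
    ≡⟨ ∑-map without1 (sublists (subsets n (suc W))) _ ⟩
  ∑ (sublists (subsets n (suc W))) (λ a → ∑ (sublists (with1 (subsets n W))) (λ b → H (without1 a ++ b)))
    ≡⟨ ∑-cong (λ a → trans (cong (λ s → ∑ s (λ b → H (without1 a ++ b))) (sublists-map (true ∷_) (subsets n W))) (∑-map with1 (sublists (subsets n W)) _))
              (sublists (subsets n (suc W))) ⟩
  ∑ (sublists (subsets n (suc W))) (λ a → ∑ (sublists (subsets n W)) (λ b → H (without1 a ++ with1 b)))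
    ≡⟨ ∑-comm (sublists (subsets n (suc W))) (sublists (subsets n W)) (λ a b → H (without1 a ++ with1 b)) ⟩
  ∑ (sublists (subsets n W)) (λ b → ∑ (sublists (subsets n (suc W))) (λ a → H (without1 a ++ with1 b)))
    ≡⟨ ∑-cong (λ b → trans (∑-cong (λ a → split a b) (sublists (subsets n (suc W))))
                           (∑-when (valid n (linkEnv σ) b) (sublists (subsets n (suc W))) _))
              (sublists (subsets n W)) ⟩
  ∑ (sublists (subsets n W)) (λ b → when (valid n (linkEnv σ) b) (∑valid n (suc W) (deletionEnv σ b) (λ a → h (without1 a ++ with1 b)))) ∎
  where
  open ≡-Reasoning
  H : List (Subset (suc n)) → ℕ
  H A = when (valid (suc n) σ A) (h A)
  split : ∀ a b → H (without1 a ++ with1 b) ≡ when (valid n (linkEnv σ) b) (when (valid n (deletionEnv σ b) a) (h (without1 a ++ with1 b)))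
  split a b = trans (cong (λ c → when c (h (without1 a ++ with1 b))) (valid-split n σ a b))
                    (when-∧ (valid n (deletionEnv σ b) a) (valid n (linkEnv σ) b) _)

eqS-refl : ∀ {n} (S : Subset n) → eqS S S ≡ true
eqS-refl [] = refl
eqS-refl (true ∷ S) = eqS-refl S
eqS-refl (false ∷ S) = eqS-refl S

eqS-sound : ∀ {n} (S T : Subset n) → eqS S T ≡ true → S ≡ T
eqS-sound [] [] e = refl
eqS-sound (true ∷ S) (true ∷ T) e = cong (true ∷_) (eqS-sound S T e)
eqS-sound (false ∷ S) (false ∷ T) e = cong (false ∷_) (eqS-sound S T e)

eqS-≢ : ∀ {n} {S T : Subset n} → S ≢ T → eqS S T ≡ false
eqS-≢ {S = S} {T} S≢T with eqS S T in e
... | false = refl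
... | true = ⊥-elim (S≢T (eqS-sound S T e))

τ-∈ : ∀ {n} {F : List (Subset n)} {C} → C ∈ F → τ F C ≡ true
τ-∈ {F = S ∷ F} {C} (here refl) rewrite eqS-refl C = refl
τ-∈ {F = S ∷ F} {C} (there p) with eqS C S
... | true = refl
... | false = τ-∈ p

τ-∉ : ∀ {n} (F : List (Subset n)) {C} → (∀ S → S ∈ F → C ≢ S) → τ F C ≡ false
τ-∉ [] h = refl
τ-∉ (S ∷ F) h rewrite eqS-≢ (h S (here refl)) = τ-∉ F (λ T p → h T (there p))

card : ∀ {n} → Subset n → ℕ
card [] = 0
card (true ∷ S) = suc (card S)
card (false ∷ S) = card S

∈-subsets⇒card : ∀ {n k} {S : Subset n} → S ∈ subsets n k → card S ≡ k
∈-subsets⇒card {zero} {zero} {[]} p = refl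
∈-subsets⇒card {suc n} {zero} p with ∈-map⁻ (false ∷_) p
... | S , q , refl = ∈-subsets⇒card q
∈-subsets⇒card {suc n} {suc k} p with ∈-++⁻ (without1 (subsets n (suc k))) p
... | inj₁ q with ∈-map⁻ (false ∷_) q
...   | S , r , refl = ∈-subsets⇒card r
∈-subsets⇒card {suc n} {suc k} p | inj₂ q with ∈-map⁻ (true ∷_) q
...   | S , r , refl = cong suc (∈-subsets⇒card r)

card⇒∈-subsets : ∀ {n k} (S : Subset n) → card S ≡ k → S ∈ subsets n k
card⇒∈-subsets {zero} {zero} [] e = here refl
card⇒∈-subsets {suc n} {zero} (false ∷ S) e = ∈-map⁺ (false ∷_) (card⇒∈-subsets S e)
card⇒∈-subsets {suc n} {suc k} (false ∷ S) e = ∈-++⁺ˡ (∈-map⁺ (false ∷_) (card⇒∈-subsets S e))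
card⇒∈-subsets {suc n} {suc k} (true ∷ S) e =
  ∈-++⁺ʳ (without1 (subsets n (suc k))) (∈-map⁺ (true ∷_) (card⇒∈-subsets S (suc-injective e)))

∈-choose⇒⊆ : ∀ {A : Set} p (L : List A) {F S} → F ∈ choose p L → S ∈ F → S ∈ L
∈-choose⇒⊆ zero L (here refl) ()
∈-choose⇒⊆ (suc p) (x ∷ L) q r with ∈-++⁻ (map (x ∷_) (choose p L)) q
... | inj₂ q′ = there (∈-choose⇒⊆ (suc p) L q′ r)
... | inj₁ q′ with ∈-map⁻ (x ∷_) q′ | r
...   | _ , _ , refl | here refl = here refl
...   | _ , q″ , refl | there r′ = there (∈-choose⇒⊆ p L q″ r′)

lookup-≔ : ∀ {n} (C : Subset n) x b → lookup (C [ x ]≔ b) x ≡ b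
lookup-≔ (c ∷ C) zero b = refl
lookup-≔ (c ∷ C) (suc x) b = lookup-≔ C x b

≔-≔-restore : ∀ {n} (C : Subset n) x → lookup C x ≡ false → (C [ x ]≔ true) [ x ]≔ false ≡ C
≔-≔-restore (c ∷ C) zero e = cong (_∷ C) (sym e)
≔-≔-restore (c ∷ C) (suc x) e = cong (c ∷_) (≔-≔-restore C x e)

card-≔true : ∀ {n} (C : Subset n) x → lookup C x ≡ false → card (C [ x ]≔ true) ≡ suc (card C)
card-≔true (false ∷ C) zero e = refl
card-≔true (false ∷ C) (suc x) e = card-≔true C x e
card-≔true (true ∷ C) (suc x) e = cong suc (card-≔true C x e)

gap-of-card< : ∀ {n} (C : Subset n) → card C < n → Σ (Fin n) (λ x → lookup C x ≡ false)
gap-of-card< (false ∷ C) p = zero , refl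
gap-of-card< (true ∷ C) (s≤s p) with gap-of-card< C p
... | x , e = suc x , e

∈-gaps⇒false : ∀ {n} (C : Subset n) {x} → x ∈ gaps C → lookup C x ≡ false
∈-gaps⇒false {n} C {x} p = T-not (proj₂ (∈-filter⁻ (λ y → T? (not (lookup C y))) {xs = allFin n} p))
  where
  T-not : ∀ {b} → T (not b) → b ≡ false
  T-not {false} _ = refl

run-dead : ∀ l → run dead l ≡ dead
run-dead [] = refl
run-dead (b ∷ l) = run-dead l

≤ᵇ0≡suc≤ᵇ1 : ∀ m → (m ≤ᵇ 0) ≡ (suc m ≤ᵇ 1)
≤ᵇ0≡suc≤ᵇ1 zero = refl
≤ᵇ0≡suc≤ᵇ1 (suc m) = refl

changed : Bool → Phase
changed true = negPos
changed false = posNeg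

unchanged : Bool → Phase
unchanged true = pos
unchanged false = neg

accepts-changed : ∀ a l → accepts (changed a) l ≡ (signChanges (a ∷ l) ≤ᵇ 0)
accepts-changed true [] = refl
accepts-changed false [] = refl
accepts-changed true (true ∷ l) = accepts-changed true l
accepts-changed false (false ∷ l) = accepts-changed false l
accepts-changed true (false ∷ l) = cong alive (run-dead l)
accepts-changed false (true ∷ l) = cong alive (run-dead l)

accepts-unchanged : ∀ a l → accepts (unchanged a) l ≡ (signChanges (a ∷ l) ≤ᵇ 1)
accepts-unchanged true [] = refl
accepts-unchanged false [] = refl
accepts-unchanged true (true ∷ l) = accepts-unchanged true l
accepts-unchanged false (false ∷ l) = accepts-unchanged false l
accepts-unchanged true (false ∷ l) = trans (accepts-changed false l) (≤ᵇ0≡suc≤ᵇ1 (signChanges (false ∷ l)))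
accepts-unchanged false (true ∷ l) = trans (accepts-changed true l) (≤ᵇ0≡suc≤ᵇ1 (signChanges (true ∷ l)))

accepts-start : ∀ l → accepts start l ≡ (signChanges l ≤ᵇ 1)
accepts-start [] = refl
accepts-start (true ∷ l) = accepts-unchanged true l
accepts-start (false ∷ l) = accepts-unchanged false l

-- The phases from which a run of minus signs is accepted.
safe : Phase → Bool
safe start = true
safe neg = true
safe pos = true
safe posNeg = true
safe negPos = false
safe dead = false

AllFalse : List Bool → Set
AllFalse l = ∀ {b} → b ∈ l → b ≡ false

accepts-allFalse : ∀ s l → safe s ≡ true → AllFalse l → accepts s l ≡ true
accepts-allFalse start [] _ _ = refl
accepts-allFalse neg [] _ _ = refl
accepts-allFalse pos [] _ _ = refl
accepts-allFalse posNeg [] _ _ = refl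
accepts-allFalse s (b ∷ l) sf h rewrite h (here refl) = accepts-allFalse (step s false) l (safe-step s sf) (h ∘ there)
  where
  safe-step : ∀ s → safe s ≡ true → safe (step s false) ≡ true
  safe-step start _ = refl
  safe-step neg _ = refl
  safe-step pos _ = refl
  safe-step posNeg _ = refl

line-∉ : ∀ {n} (F : List (Subset n)) C → (∀ x → x ∈ gaps C → ∀ S → S ∈ F → C [ x ]≔ true ≢ S) → AllFalse (line F C)
line-∉ F C h p with ∈-map⁻ (λ x → τ F (C [ x ]≔ true)) p
... | x , q , refl = τ-∉ F (h x q)

line-offCard : ∀ {n d} (F : List (Subset n)) C → (∀ S → S ∈ F → card S ≡ suc d) → card C ≢ d → AllFalse (line F C)
line-offCard F C cardF ne = line-∉ F C (λ x q S r e → ne (suc-injective (begin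
  suc (card C)         ≡⟨ sym (card-≔true C x (∈-gaps⇒false C q)) ⟩
  card (C [ x ]≔ true) ≡⟨ cong card e ⟩
  card S               ≡⟨ cardF S r ⟩
  _ ∎)))
  where open ≡-Reasoning

bool-ext : ∀ {a b : Bool} → (a ≡ true → b ≡ true) → (b ≡ true → a ≡ true) → a ≡ b
bool-ext {true} f g = sym (f refl)
bool-ext {false} {false} f g = refl
bool-ext {false} {true} f g = g refl

isCoSignotope≡valid : ∀ n d F → suc d ≤ n → (∀ S → S ∈ F → card S ≡ suc d) →
  isCoSignotope n (suc d) F ≡ valid n fresh F
isCoSignotope≡valid n d F d<n cardF = bool-ext to from
  where
  fromLine : ∀ C → accepts start (line F C) ≡ true → ∀ b → (not b ∨ (signChanges (line F C) ≤ᵇ 1)) ≡ true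
  fromLine C acc false = refl
  fromLine C acc true = trans (sym (accepts-start (line F C))) acc
  from : valid n fresh F ≡ true → isCoSignotope n (suc d) F ≡ true
  from v = all-intro _ (subsets n (suc d)) (λ B _ → all-intro _ (allFin n) (λ i _ →
             fromLine (B [ i ]≔ false) (all-elim _ v (∈-everySubset (B [ i ]≔ false))) (lookup B i)))
  toLine : isCoSignotope n (suc d) F ≡ true → ∀ C → accepts start (line F C) ≡ true
  toLine c C with card C ≟ d
  ... | no ne = accepts-allFalse start (line F C) refl (line-offCard F C cardF ne)
  ... | yes e with gap-of-card< C (≤-trans (s≤s (≤-reflexive e)) d<n)
  ...   | x , free = begin
    accepts start (line F C)                                ≡⟨ cong (accepts start ∘ line F) (sym (≔-≔-restore C x free)) ⟩
    accepts start (line F (C⁺ [ x ]≔ false))                ≡⟨ accepts-start (line F (C⁺ [ x ]≔ false)) ⟩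
    signChanges (signSeq F C⁺ x) ≤ᵇ 1                       ≡⟨ subst (λ b → (not b ∨ (signChanges (signSeq F C⁺ x) ≤ᵇ 1)) ≡ true) (lookup-≔ C x true) okC⁺ ⟩
    true ∎
    where
    open ≡-Reasoning
    C⁺ = C [ x ]≔ true
    okC⁺ = all-elim _ (all-elim _ c (card⇒∈-subsets C⁺ (trans (card-≔true C x free) (cong suc e)))) (∈-allFin x)
  to : isCoSignotope n (suc d) F ≡ true → valid n fresh F ≡ true
  to c = all-intro _ (everySubset n) (λ C _ → toLine c C)

∑-choose : ∀ {A : Set} p (L : List A) (g : List A → ℕ) →
  ∑ (choose p L) g ≡ ∑ (sublists L) (λ a → when (length a ≡ᵇ p) (g a))
∑-choose zero [] g = refl
∑-choose (suc p) [] g = refl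
∑-choose zero (x ∷ L) g = begin
  g [] + 0                                                           ≡⟨ ∑-choose zero L g ⟩
  ∑ (sublists L) (λ a → when (length a ≡ᵇ 0) (g a))                  ≡⟨ cong (_+ ∑ (sublists L) (λ a → when (length a ≡ᵇ 0) (g a))) (sym (∑-zero (sublists L) (λ _ _ → refl))) ⟩
  ∑ (sublists L) (λ a → when (length (x ∷ a) ≡ᵇ 0) (g (x ∷ a))) + _  ≡⟨ cong (_+ _) (sym (∑-map (x ∷_) (sublists L) _)) ⟩
  ∑ (map (x ∷_) (sublists L)) (λ a → when (length a ≡ᵇ 0) (g a)) + _ ≡⟨ sym (∑-++ (map (x ∷_) (sublists L)) (sublists L) _) ⟩
  ∑ (sublists (x ∷ L)) (λ a → when (length a ≡ᵇ 0) (g a)) ∎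
  where open ≡-Reasoning
∑-choose (suc p) (x ∷ L) g = begin
  ∑ (map (x ∷_) (choose p L) ++ choose (suc p) L) g
    ≡⟨ ∑-++ (map (x ∷_) (choose p L)) (choose (suc p) L) g ⟩
  ∑ (map (x ∷_) (choose p L)) g + ∑ (choose (suc p) L) g
    ≡⟨ cong₂ _+_ (trans (∑-map (x ∷_) (choose p L) g) (∑-choose p L (g ∘ (x ∷_)))) (∑-choose (suc p) L g) ⟩
  ∑ (sublists L) (λ a → when (length a ≡ᵇ p) (g (x ∷ a))) + _
    ≡⟨ cong (_+ _) (sym (∑-map (x ∷_) (sublists L) _)) ⟩
  ∑ (map (x ∷_) (sublists L)) (λ a → when (length a ≡ᵇ suc p) (g a)) + _
    ≡⟨ sym (∑-++ (map (x ∷_) (sublists L)) (sublists L) _) ⟩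
  ∑ (sublists (x ∷ L)) (λ a → when (length a ≡ᵇ suc p) (g a)) ∎
  where open ≡-Reasoning

sized : ∀ {A : Set} → ℕ → List A → ℕ
sized p A = when (length A ≡ᵇ p) 1

count : ℕ → ℕ → ℕ → ℕ
count p n W = ∑valid n W fresh (sized p)

coSigCount≡count : ∀ n d p → suc d ≤ n → coSigCount n (suc d) p ≡ count p n (suc d)
coSigCount≡count n d p d<n = begin
  length (filterᵇ (isCoSignotope n (suc d)) (choose p L))           ≡⟨ length-filterᵇ (isCoSignotope n (suc d)) (choose p L) ⟩
  ∑ (choose p L) (λ F → when (isCoSignotope n (suc d) F) 1)          ≡⟨ ∑-cong-∈ (choose p L) (λ F q → cong (λ c → when c 1)
                                                                          (isCoSignotope≡valid n d F d<n (λ S r → ∈-subsets⇒card (∈-choose⇒⊆ p L q r)))) ⟩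
  ∑ (choose p L) (λ F → when (valid n fresh F) 1)                    ≡⟨ ∑-choose p L _ ⟩
  ∑ (sublists L) (λ F → when (length F ≡ᵇ p) (when (valid n fresh F) 1)) ≡⟨ ∑-cong (λ F → when-comm (length F ≡ᵇ p) (valid n fresh F) 1) (sublists L) ⟩
  count p n (suc d) ∎
  where
  open ≡-Reasoning
  L = subsets n (suc d)

∑valid-cong-env : ∀ n W {σ σ′ : Subset n → Phase} h → (∀ C → σ C ≡ σ′ C) → ∑valid n W σ h ≡ ∑valid n W σ′ h
∑valid-cong-env n W h e = ∑-cong (λ A → cong (λ c → when c (h A)) (valid-cong-env n A e)) (sublists (subsets n W))

∑valid-cong-weight : ∀ n W σ {h h′ : List (Subset n) → ℕ} → (∀ A → h A ≡ h′ A) → ∑valid n W σ h ≡ ∑valid n W σ h′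
∑valid-cong-weight n W σ e = ∑-cong (λ A → cong (when (valid n σ A)) (e A)) (sublists (subsets n W))

∑valid-zero : ∀ n W σ h → (∀ A → h A ≡ 0) → ∑valid n W σ h ≡ 0
∑valid-zero n W σ h e = ∑-zero (sublists (subsets n W)) (λ A _ → trans (cong (when (valid n σ A)) (e A)) (when-zero (valid n σ A)))

line-[] : ∀ {n} (C : Subset n) → AllFalse (line [] C)
line-[] C = line-∉ [] C (λ _ _ _ ())

valid-[] : ∀ n (σ : Subset n → Phase) → (∀ C → safe (σ C) ≡ true) → valid n σ [] ≡ true
valid-[] n σ sf = all-intro _ (everySubset n) (λ C _ → accepts-allFalse (σ C) (line [] C) (sf C) (line-[] C))

valid⇒accepts : ∀ n {σ} F → valid n σ F ≡ true → ∀ C → accepts (σ C) (line F C) ≡ true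
valid⇒accepts n F v C = all-elim _ v (∈-everySubset C)

valid-dead : ∀ n (σ : Subset n → Phase) F C → σ C ≡ dead → valid n σ F ≡ false
valid-dead n σ F C e with valid n σ F in v
... | false = refl
... | true with trans (cong (λ s → accepts s (line F C)) (sym e)) (valid⇒accepts n F v C)
...   | acc rewrite run-dead (line F C) with acc
...     | ()

trues : List Bool → ℕ
trues [] = 0
trues (true ∷ l) = suc (trues l)
trues (false ∷ l) = trues l

trues-negPos : ∀ l → accepts negPos l ≡ true → trues l ≡ length l
trues-negPos [] _ = refl
trues-negPos (true ∷ l) acc = cong suc (trues-negPos l acc)
trues-negPos (false ∷ l) acc rewrite run-dead l with acc
... | ()

trues-posNeg : ∀ l → accepts posNeg l ≡ true → trues l ≡ 0
trues-posNeg [] _ = refl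
trues-posNeg (false ∷ l) acc = trues-posNeg l acc
trues-posNeg (true ∷ l) acc rewrite run-dead l with acc
... | ()

trues-∨ : ∀ {A : Set} (f g : A → Bool) xs → trues (map (λ x → f x ∨ g x) xs) ≤ trues (map f xs) + trues (map g xs)
trues-∨ f g [] = z≤n
trues-∨ f g (x ∷ xs) with f x | g x
... | true | true = s≤s (≤-trans (trues-∨ f g xs) (+-monoʳ-≤ (trues (map f xs)) (n≤1+n _)))
... | true | false = s≤s (trues-∨ f g xs)
... | false | true = subst (suc (trues (map (λ x → f x ∨ g x) xs)) ≤_) (sym (+-suc _ _)) (s≤s (trues-∨ f g xs))
... | false | false = trues-∨ f g xs

trues-allFalse : ∀ l → AllFalse l → trues l ≡ 0
trues-allFalse [] _ = refl
trues-allFalse (b ∷ l) h rewrite h (here refl) = trues-allFalse l (h ∘ there)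

trues-line-single : ∀ {n} (C S : Subset n) → trues (line [ S ] C) ≤ 1
trues-line-single [] [] = z≤n
trues-line-single (false ∷ C) (true ∷ S) =
  subst (λ l → trues l ≤ 1) (sym (line-false∷ [ true ∷ S ] C)) (head≤1 (τ [ S ] C) (line-[] C))
  where
  head≤1 : ∀ b {l} → AllFalse l → trues (b ∷ l) ≤ 1
  head≤1 true h = s≤s (≤-reflexive (trues-allFalse _ h))
  head≤1 false h = ≤-trans (≤-reflexive (trues-allFalse _ h)) z≤n
trues-line-single (false ∷ C) (false ∷ S) =
  subst (λ l → trues l ≤ 1) (sym (line-false∷ [ false ∷ S ] C)) (trues-line-single C S)
trues-line-single (true ∷ C) (true ∷ S) =
  subst (λ l → trues l ≤ 1) (sym (line-true∷ [ true ∷ S ] C)) (trues-line-single C S)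
trues-line-single (true ∷ C) (false ∷ S) =
  subst (λ l → trues l ≤ 1) (sym (line-true∷ [ false ∷ S ] C)) (≤-trans (≤-reflexive (trues-allFalse _ (line-[] C))) z≤n)

trues-line≤length : ∀ {n} (F : List (Subset n)) C → trues (line F C) ≤ length F
trues-line≤length [] C = ≤-reflexive (trues-allFalse _ (line-[] C))
trues-line≤length (S ∷ F) C =
  ≤-trans (trues-∨ (λ x → eqS (C [ x ]≔ true) S) (λ x → τ F (C [ x ]≔ true)) (gaps C))
          (+-mono-≤ (subst (λ l → trues l ≤ 1) (map-cong (λ x → ∨-identityʳ (eqS (C [ x ]≔ true) S)) (gaps C)) (trues-line-single C S))
                    (trues-line≤length F C))

-- A line in phase negPos is all plus, so F has a member on each of its points.
negPos⇒gaps≤length : ∀ n (σ : Subset n → Phase) F C → σ C ≡ negPos → valid n σ F ≡ true → length (gaps C) ≤ length F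
negPos⇒gaps≤length n σ F C e v = subst (_≤ length F) (trans (trues-negPos (line F C) acc) (length-map _ (gaps C))) (trues-line≤length F C)
  where
  acc : accepts negPos (line F C) ≡ true
  acc = trans (cong (λ s → accepts s (line F C)) (sym e)) (valid⇒accepts n F v C)

∑valid-negPos : ∀ n W (σ : Subset n → Phase) h C → σ C ≡ negPos → (∀ A → length (gaps C) ≤ length A → h A ≡ 0) → ∑valid n W σ h ≡ 0
∑valid-negPos n W σ h C e hz = ∑-zero (sublists (subsets n W)) (λ A _ → term A)
  where
  term : ∀ A → when (valid n σ A) (h A) ≡ 0
  term A with valid n σ A in v
  ... | false = refl
  ... | true = hz A (negPos⇒gaps≤length n σ A C e v)

length-gaps+card : ∀ {n} (C : Subset n) → length (gaps C) + card C ≡ n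
length-gaps+card [] = refl
length-gaps+card (false ∷ C) = begin
  length (gaps (false ∷ C)) + card C      ≡⟨ cong (λ l → length l + card C) (gaps-false∷ C) ⟩
  suc (length (map suc (gaps C)) + card C) ≡⟨ cong (λ m → suc (m + card C)) (length-map suc (gaps C)) ⟩
  suc (length (gaps C) + card C)           ≡⟨ cong suc (length-gaps+card C) ⟩
  _ ∎
  where open ≡-Reasoning
length-gaps+card (true ∷ C) = begin
  length (gaps (true ∷ C)) + suc (card C)  ≡⟨ cong (λ l → length l + suc (card C)) (gaps-true∷ C) ⟩
  length (map suc (gaps C)) + suc (card C) ≡⟨ cong (_+ suc (card C)) (length-map suc (gaps C)) ⟩
  length (gaps C) + suc (card C)           ≡⟨ +-suc (length (gaps C)) (card C) ⟩
  suc (length (gaps C) + card C)           ≡⟨ cong suc (length-gaps+card C) ⟩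
  _ ∎
  where open ≡-Reasoning

length-gaps : ∀ {n W} {C : Subset n} → C ∈ subsets n W → length (gaps C) ≡ n ∸ W
length-gaps {n} {W} {C} p = trans (sym (m+n∸n≡m (length (gaps C)) (card C))) (cong₂ _∸_ (length-gaps+card C) (∈-subsets⇒card p))

card≤ : ∀ {n} (C : Subset n) → card C ≤ n
card≤ [] = z≤n
card≤ (true ∷ C) = s≤s (card≤ C)
card≤ (false ∷ C) = m≤n⇒m≤1+n (card≤ C)

subsets-unique : ∀ n W → Unique (subsets n W)
subsets-unique zero zero = All.[] ∷ []
subsets-unique zero (suc W) = []
subsets-unique (suc n) zero = map⁺ ∷-injectiveʳ (subsets-unique n zero)
subsets-unique (suc n) (suc W) = ++⁺ (map⁺ ∷-injectiveʳ (subsets-unique n (suc W))) (map⁺ ∷-injectiveʳ (subsets-unique n W)) disjoint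
  where
  disjoint : ∀ {v} → ¬ (v ∈ without1 (subsets n (suc W)) × v ∈ with1 (subsets n W))
  disjoint (p , q) with ∈-map⁻ (false ∷_) p | ∈-map⁻ (true ∷_) q
  ... | _ , _ , refl | _ , _ , ()

-- Families whose lines have read a minus

-- The last W elements of [n].
top : (n W : ℕ) → Subset n
top zero W = []
top (suc n) W = if W ≤ᵇ n then false ∷ top n W else true ∷ top n (pred W)

≤⇒≤ᵇ≡true : ∀ {m n} → m ≤ n → (m ≤ᵇ n) ≡ true
≤⇒≤ᵇ≡true {m} {n} p with m ≤ᵇ n | ≤⇒≤ᵇ p
... | true | _ = refl

suc≤ᵇ≡false : ∀ n → (suc n ≤ᵇ n) ≡ false
suc≤ᵇ≡false zero = refl
suc≤ᵇ≡false (suc n) = suc≤ᵇ≡false n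

top-false∷ : ∀ {n W} → W ≤ n → top (suc n) W ≡ false ∷ top n W
top-false∷ {n} {W} p rewrite ≤⇒≤ᵇ≡true p = refl

top-full : ∀ n → top (suc n) (suc n) ≡ true ∷ top n n
top-full n rewrite suc≤ᵇ≡false n = refl

-- Peeling element 1 off top (suc n) (suc W): either 1 ∉ top, or the set is all of [suc n].
top-cases : ∀ {n W} → suc W ≤ suc n → (suc W ≤ n) ⊎ (W ≡ n)
top-cases {n} {W} (s≤s p) with W ≟ n
... | yes e = inj₂ e
... | no ne = inj₁ (≤∧≢⇒< p ne)

card-top : ∀ n W → W ≤ n → card (top n W) ≡ W
card-top zero zero p = refl
card-top (suc n) zero p rewrite top-false∷ {n} {0} z≤n = card-top n zero z≤n
card-top (suc n) (suc W) p with top-cases p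
... | inj₁ q rewrite top-false∷ q = card-top n (suc W) q
... | inj₂ refl rewrite top-full n = cong suc (card-top n n ≤-refl)

top∈subsets : ∀ n W → W ≤ n → top n W ∈ subsets n W
top∈subsets n W p = card⇒∈-subsets (top n W) (card-top n W p)

card≡n⇒top : ∀ n (C : Subset n) → card C ≡ n → C ≡ top n n
card≡n⇒top zero [] e = refl
card≡n⇒top (suc n) (true ∷ C) e rewrite top-full n = cong (true ∷_) (card≡n⇒top n C (suc-injective e))
card≡n⇒top (suc n) (false ∷ C) e = ⊥-elim (<-irrefl refl (subst (_≤ n) e (card≤ C)))

card≡n⇒gaps≡[] : ∀ {n} (C : Subset n) → card C ≡ n → gaps C ≡ []
card≡n⇒gaps≡[] {n} C e with gaps C | +-cancelʳ-≡ n (length (gaps C)) 0 (trans (cong (length (gaps C) +_) (sym e)) (length-gaps+card C))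
... | [] | _ = refl

negPos-full⇒valid-[] : ∀ n (σ : Subset n → Phase) → (∀ C → (safe (σ C) ≡ true) ⊎ ((σ C ≡ negPos) × (card C ≡ n))) → valid n σ [] ≡ true
negPos-full⇒valid-[] n σ h = all-intro _ (everySubset n) (λ C _ → acc C (h C))
  where
  acc : ∀ C → (safe (σ C) ≡ true) ⊎ ((σ C ≡ negPos) × (card C ≡ n)) → accepts (σ C) (line [] C) ≡ true
  acc C (inj₁ sf) = accepts-allFalse (σ C) (line [] C) sf (line-[] C)
  acc C (inj₂ (e , full)) rewrite e = cong (λ l → accepts negPos (map (λ x → τ [] (C [ x ]≔ true)) l)) (card≡n⇒gaps≡[] C full)

negPos-nonfull⇒invalid-[] : ∀ n (σ : Subset n → Phase) C → σ C ≡ negPos → 0 < length (gaps C) → valid n σ [] ≡ false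
negPos-nonfull⇒invalid-[] n σ C e p with valid n σ [] in v
... | false = refl
... | true = ⊥-elim (<-irrefl refl (≤-trans p (negPos⇒gaps≤length n σ [] C e v)))

-- The environment of the deletion when the link is empty: every line has read the minus at element 1.
negEnv : ∀ {n} → Subset n → Phase
negEnv _ = neg

∧-true : ∀ {a b} → (a ∧ b) ≡ true → (a ≡ true) × (b ≡ true)
∧-true {true} e = refl , e

valid-negEnv-top : ∀ n W → W ≤ n → valid n negEnv [ top n W ] ≡ true
valid-negEnv-top zero zero p = refl
valid-negEnv-top (suc n) zero p rewrite top-false∷ {n} {0} z≤n | valid-suc n negEnv [ false ∷ top n 0 ] | valid-negEnv-top n 0 z≤n =
  valid-[] n negEnv (λ _ → refl)
valid-negEnv-top (suc n) (suc W) p with top-cases p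
... | inj₁ q rewrite top-false∷ q | valid-suc n negEnv [ false ∷ top n (suc W) ] | valid-negEnv-top n (suc W) q =
  valid-[] n negEnv (λ _ → refl)
... | inj₂ refl rewrite top-full n | valid-suc n negEnv [ true ∷ top n n ] | valid-negEnv-top n n ≤-refl =
  cong (_∧ true) (negPos-full⇒valid-[] n _ phase)
  where
  phase : ∀ C → (safe (step neg (eqS C (top n n) ∨ false)) ≡ true) ⊎ ((step neg (eqS C (top n n) ∨ false) ≡ negPos) × (card C ≡ n))
  phase C with eqS C (top n n) in e
  ... | false = inj₁ refl
  ... | true = inj₂ (refl , trans (cong card (eqS-sound C (top n n) e)) (card-top n n ≤-refl))

valid-negEnv-single⇒top : ∀ n W x → card x ≡ W → valid n negEnv [ x ] ≡ true → x ≡ top n W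
valid-negEnv-single⇒top zero W [] _ _ = refl
valid-negEnv-single⇒top (suc n) W (false ∷ x) cx v rewrite valid-suc n negEnv [ false ∷ x ] =
  trans (cong (false ∷_) (valid-negEnv-single⇒top n W x cx (proj₁ (∧-true v)))) (sym (top-false∷ (subst (_≤ n) cx (card≤ x))))
valid-negEnv-single⇒top (suc n) W (true ∷ x) cx v rewrite valid-suc n negEnv [ true ∷ x ] = goal
  where
  x-negPos : deletionEnv negEnv [ x ] x ≡ negPos
  x-negPos rewrite eqS-refl x = refl
  full : card x ≡ n
  full = trans (sym (cong (_+ card x) (n≤0⇒n≡0 (negPos⇒gaps≤length n _ [] x x-negPos (proj₁ (∧-true v)))))) (length-gaps+card x)
  goal : true ∷ x ≡ top (suc n) W
  goal rewrite sym cx | full | top-full n = cong (true ∷_) (valid-negEnv-single⇒top n n x full (proj₂ (∧-true v)))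

∑-valid-negEnv-single : ∀ n W (f : Subset n → ℕ) → W ≤ n → ∑ (subsets n W) (λ x → when (valid n negEnv [ x ]) (f x)) ≡ f (top n W)
∑-valid-negEnv-single n W f p =
  trans (∑-unique-support _ (subsets-unique n W) (top∈subsets n W p) off)
        (cong (λ c → when c (f (top n W))) (valid-negEnv-top n W p))
  where
  off : ∀ x → x ∈ subsets n W → x ≢ top n W → when (valid n negEnv [ x ]) (f x) ≡ 0
  off x q ne with valid n negEnv [ x ] in v
  ... | false = refl
  ... | true = ⊥-elim (ne (valid-negEnv-single⇒top n W x (∈-subsets⇒card q) v))

∑valid-singles : ∀ n W σ (f : List (Subset n) → ℕ) → ∑valid n W σ (λ b → when (length b ≡ᵇ 1) (f b)) ≡ ∑ (subsets n W) (λ x → when (valid n σ [ x ]) (f [ x ]))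
∑valid-singles n W σ f = trans (∑-cong (λ b → when-comm (valid n σ b) (length b ≡ᵇ 1) (f b)) (sublists (subsets n W)))
                               (∑-sublists-length1 (subsets n W) (λ b → when (valid n σ b) (f b)))

∑valid-negEnv-singles : ∀ n W (f : List (Subset n) → ℕ) → W ≤ n → ∑valid n W negEnv (λ b → when (length b ≡ᵇ 1) (f b)) ≡ f [ top n W ]
∑valid-negEnv-singles n W f p = trans (∑valid-singles n W negEnv f) (∑-valid-negEnv-single n W (f ∘ [_]) p)

∑valid-negEnv-sized1 : ∀ n W → W ≤ n → ∑valid n W negEnv (sized 1) ≡ 1
∑valid-negEnv-sized1 n W p = ∑valid-negEnv-singles n W (λ _ → 1) p

seenNeg : Phase → Bool
seenNeg neg = true
seenNeg posNeg = true
seenNeg negPos = true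
seenNeg _ = false

step-seenNeg : ∀ s b → seenNeg s ≡ true → (seenNeg (step s b) ≡ true) ⊎ (step s b ≡ dead)
step-seenNeg neg false _ = inj₁ refl
step-seenNeg neg true _ = inj₁ refl
step-seenNeg posNeg false _ = inj₁ refl
step-seenNeg posNeg true _ = inj₂ refl
step-seenNeg negPos false _ = inj₂ refl
step-seenNeg negPos true _ = inj₁ refl

step-seenNeg-true : ∀ s → seenNeg s ≡ true → (step s true ≡ negPos) ⊎ (step s true ≡ dead)
step-seenNeg-true neg _ = inj₁ refl
step-seenNeg-true posNeg _ = inj₂ refl
step-seenNeg-true negPos _ = inj₁ refl

-- A line through a link member reads a plus next, so it needs all its points in the deletion.
seenNeg-link⇒full : ∀ n (σ : Subset (suc n) → Phase) b {C} → seenNeg (σ (false ∷ C)) ≡ true → C ∈ b →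
  valid n (deletionEnv σ b) [] ≡ true → card C ≡ n
seenNeg-link⇒full n σ b {C} sn C∈b v with step-seenNeg-true (σ (false ∷ C)) sn
... | inj₂ isDead with trans (sym v) (valid-dead n _ [] C (trans (cong (step (σ (false ∷ C))) (τ-∈ C∈b)) isDead))
...   | ()
seenNeg-link⇒full n σ b {C} sn C∈b v | inj₁ isNegPos =
  trans (sym (cong (_+ card C) (n≤0⇒n≡0 (negPos⇒gaps≤length n _ [] C (trans (cong (step (σ (false ∷ C))) (τ-∈ C∈b)) isNegPos) v))))
        (length-gaps+card C)

seenNeg-link⇒invalid-[] : ∀ n (σ : Subset (suc n) → Phase) b {C} → seenNeg (σ (false ∷ C)) ≡ true → C ∈ b →
  0 < length (gaps C) → valid n (deletionEnv σ b) [] ≡ false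
seenNeg-link⇒invalid-[] n σ b {C} sn C∈b p with valid n (deletionEnv σ b) [] in v
... | false = refl
... | true = ⊥-elim (<-irrefl (sym (card≡n⇒gaps≡0 (seenNeg-link⇒full n σ b sn C∈b v))) p)
  where
  card≡n⇒gaps≡0 : card C ≡ n → length (gaps C) ≡ 0
  card≡n⇒gaps≡0 e = cong length (card≡n⇒gaps≡[] C e)

deletion-∈ : ∀ {n} (a : List (Subset (suc n))) {S} → S ∈ deletion a → (false ∷ S) ∈ a
deletion-∈ ((false ∷ w) ∷ a) (here refl) = here refl
deletion-∈ ((false ∷ w) ∷ a) (there p) = there (deletion-∈ a p)
deletion-∈ ((true ∷ w) ∷ a) p = there (deletion-∈ a p)

link-∈ : ∀ {n} (a : List (Subset (suc n))) {S} → S ∈ link a → (true ∷ S) ∈ a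
link-∈ ((true ∷ w) ∷ a) (here refl) = here refl
link-∈ ((true ∷ w) ∷ a) (there p) = there (link-∈ a p)
link-∈ ((false ∷ w) ∷ a) p = there (link-∈ a p)

link-nonempty : ∀ {n} (a : List (Subset (suc n))) → a ≢ [] → deletion a ≡ [] → ∃ (λ C → C ∈ link a)
link-nonempty [] ne e = ⊥-elim (ne refl)
link-nonempty ((true ∷ w) ∷ a) ne e = w , here refl

-- When every line has seen a minus sign, plus signs must form final segments, which forces the top set in.
seenNeg⇒top∈ : ∀ n W (σ : Subset n → Phase) a → (∀ C → seenNeg (σ C) ≡ true) → a ≢ [] →
  (∀ S → S ∈ a → card S ≡ W) → valid n σ a ≡ true → τ a (top n W) ≡ true
seenNeg⇒top∈ zero W σ ([] ∷ a) _ _ _ _ = refl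
seenNeg⇒top∈ zero W σ [] _ ne _ _ = ⊥-elim (ne refl)
seenNeg⇒top∈ (suc n) W σ a sn ne cardA v = byDeletion (deletion a) refl
  where
  σ′ = deletionEnv σ (link a)
  vσ′ : valid n σ′ (deletion a) ≡ true
  vσ′ = proj₁ (∧-true (trans (sym (valid-suc n σ a)) v))
  byDeletion : ∀ a₀ → deletion a ≡ a₀ → τ a (top (suc n) W) ≡ true
  byDeletion [] e₀ with link-nonempty a ne e₀
  ... | C , C∈link = goal
    where
    full : card C ≡ n
    full = seenNeg-link⇒full n σ (link a) (sn (false ∷ C)) C∈link (subst (λ l → valid n σ′ l ≡ true) e₀ vσ′)
    W≡ : W ≡ suc n
    W≡ = trans (sym (cardA (true ∷ C) (link-∈ a C∈link))) (cong suc full)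
    goal : τ a (top (suc n) W) ≡ true
    goal rewrite W≡ | top-full n = trans (τ-link a (top n n)) (τ-∈ (subst (_∈ link a) (card≡n⇒top n C full) C∈link))
  byDeletion (x ∷ a₀) e₀ = goal
    where
    sn′ : ∀ C → seenNeg (σ′ C) ≡ true
    sn′ C with step-seenNeg (σ (false ∷ C)) (τ (link a) C) (sn (false ∷ C))
    ... | inj₁ q = q
    ... | inj₂ isDead with trans (sym vσ′) (valid-dead n σ′ (deletion a) C isDead)
    ...   | ()
    x∈ : x ∈ deletion a
    x∈ = subst (x ∈_) (sym e₀) (here refl)
    cx : card x ≡ W
    cx = cardA (false ∷ x) (deletion-∈ a x∈)
    ne′ : deletion a ≢ []
    ne′ q with trans (sym e₀) q
    ... | ()
    goal : τ a (top (suc n) W) ≡ true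
    goal rewrite top-false∷ (subst (_≤ n) cx (card≤ x)) =
      trans (τ-deletion a (top n W)) (seenNeg⇒top∈ n W σ′ (deletion a) sn′ ne′ (λ S p → cardA (false ∷ S) (deletion-∈ a p)) vσ′)

∈-gaps : ∀ {n} (C : Subset n) {x} → lookup C x ≡ false → x ∈ gaps C
∈-gaps {n} C {x} e = ∈-filter⁺ (λ y → T? (not (lookup C y))) (∈-allFin x) (subst (λ b → T (not b)) (sym e) _)

top-grow : ∀ n W → suc W ≤ n → Σ (Fin n) (λ x → (lookup (top n W) x ≡ false) × (top n W [ x ]≔ true ≡ top n (suc W)))
top-grow (suc n) W p with top-cases p
... | inj₁ q rewrite top-false∷ q | top-false∷ (≤-trans (n≤1+n W) q) with top-grow n W q
...   | x , free , e = suc x , free , cong (false ∷_) e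
top-grow (suc n) W p | inj₂ refl rewrite top-false∷ (≤-refl {W}) | top-full W = zero , refl , refl

-- By seenNeg⇒top∈ the top (W+1)-set is in a, but it lies on the line through top n W, where posNeg forbids a plus.
posNeg-top⇒invalid : ∀ n W (σ : Subset n → Phase) a → suc W ≤ n → (∀ C → seenNeg (σ C) ≡ true) → σ (top n W) ≡ posNeg →
  a ≢ [] → (∀ S → S ∈ a → card S ≡ suc W) → valid n σ a ≡ false
posNeg-top⇒invalid n W σ a le sn pn ne cardA with valid n σ a in v
... | false = refl
... | true with top-grow n W le
...   | x , free , e with trues-posNeg (line a (top n W)) (trans (cong (λ s → accepts s (line a (top n W))) (sym pn)) (valid⇒accepts n a v (top n W)))
...     | none = ⊥-elim (trues≢0 (line a (top n W)) plus∈ none)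
  where
  plus∈ : true ∈ line a (top n W)
  plus∈ = subst (_∈ line a (top n W)) (trans (cong (τ a) e) (seenNeg⇒top∈ n (suc W) σ a sn ne cardA v))
                (∈-map⁺ (λ y → τ a (top n W [ y ]≔ true)) (∈-gaps (top n W) free))
  trues≢0 : ∀ l → true ∈ l → trues l ≢ 0
  trues≢0 (true ∷ l) _ ()
  trues≢0 (false ∷ l) (there p) = trues≢0 l p

∑valid-posNeg-top : ∀ n W (σ : Subset n → Phase) h → suc W ≤ n → (∀ C → seenNeg (σ C) ≡ true) → σ (top n W) ≡ posNeg → h [] ≡ 0 →
  ∑valid n (suc W) σ h ≡ 0
∑valid-posNeg-top n W σ h le sn pn h[] = ∑-zero (sublists (subsets n (suc W))) term
  where
  term : ∀ a → a ∈ sublists (subsets n (suc W)) → when (valid n σ a) (h a) ≡ 0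
  term [] _ = trans (cong (when (valid n σ [])) h[]) (when-zero (valid n σ []))
  term (S ∷ a) p = cong (λ c → when c (h (S ∷ a)))
    (posNeg-top⇒invalid n W σ (S ∷ a) le sn pn (λ ()) (λ T q → ∈-subsets⇒card (∈-sublists⇒⊆ p q)))

length-split : ∀ {n} (a b : List (Subset n)) → length (without1 a ++ with1 b) ≡ length a + length b
length-split [] b = length-map (true ∷_) b
length-split (x ∷ a) b = cong suc (length-split a b)

≡ᵇ-false : ∀ {m q} → q < m → (m ≡ᵇ q) ≡ false
≡ᵇ-false {m} {q} q<m with m ≡ᵇ q in e
... | false = refl
... | true = ⊥-elim (<⇒≢ q<m (sym (≡ᵇ⇒≡ m q (subst T (sym e) _))))

≡ᵇ-cancelˡ : ∀ k m q → (k + m ≡ᵇ k + q) ≡ (m ≡ᵇ q)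
≡ᵇ-cancelˡ zero m q = refl
≡ᵇ-cancelˡ (suc k) m q = ≡ᵇ-cancelˡ k m q

sized-split : ∀ {n} q (a b : List (Subset n)) → sized (length b + q) (without1 a ++ with1 b) ≡ sized q a
sized-split q a b = cong (λ c → when c 1) (begin
  (length (without1 a ++ with1 b) ≡ᵇ length b + q) ≡⟨ cong (_≡ᵇ length b + q) (trans (length-split a b) (+-comm (length a) (length b))) ⟩
  (length b + length a ≡ᵇ length b + q)       ≡⟨ ≡ᵇ-cancelˡ (length b) (length a) q ⟩
  (length a ≡ᵇ q) ∎)
  where open ≡-Reasoning

length-split-over : ∀ {n} q (a b : List (Subset n)) → q < length a + length b → (length (without1 a ++ with1 b) ≡ᵇ q) ≡ false
length-split-over q a b lt = ≡ᵇ-false (subst (q <_) (sym (length-split a b)) lt)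

length-over-gap : ∀ {n} q W (a b : List (Subset n)) → q + W ≤ n → n ∸ W ≤ length a → b ≢ [] →
  (length (without1 a ++ with1 b) ≡ᵇ q) ≡ false
length-over-gap q W a [] le l ne = ⊥-elim (ne refl)
length-over-gap q W a (x ∷ b) le l _ = length-split-over q a (x ∷ b) (≤-<-trans (≤-trans (m+n≤o⇒m≤o∸n q le) l) (m<m+n (length a) z<s))

-- A link member x turns the line through x negPos, which needs n ∸ W deletion sets on it.
∑valid-link∋ : ∀ n W (σ : Subset (suc n) → Phase) b x h → x ∈ subsets n W → x ∈ b →
  (step (σ (false ∷ x)) true ≡ negPos) → (∀ a → n ∸ W ≤ length a → h a ≡ 0) →
  ∑valid n (suc W) (deletionEnv σ b) h ≡ 0
∑valid-link∋ n W σ b x h x∈ x∈b np hz =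
  ∑valid-negPos n (suc W) (deletionEnv σ b) h x (trans (cong (step (σ (false ∷ x))) (τ-∈ x∈b)) np)
    (λ a q → hz a (subst (_≤ length a) (length-gaps x∈) q))

-- If the lines avoiding element 1 have seen a minus, a family with large enough gap n ∸ W has empty link.
∑valid-emptyLink : ∀ n W (σ : Subset (suc n) → Phase) h →
  (∀ C → C ∈ subsets n W → σ (false ∷ C) ≡ neg) →
  (∀ a b x → n ∸ W ≤ length a → h (without1 a ++ with1 (x ∷ b)) ≡ 0) →
  ∑valid (suc n) (suc W) σ h ≡ when (valid n (linkEnv σ) []) (∑valid n (suc W) (deletionEnv σ []) (λ a → h (without1 a ++ [])))
∑valid-emptyLink n W σ h neg₀ hz = trans (∑valid-suc n W σ h) (∑-sublists-[] (subsets n W) _ vanish)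
  where
  vanish : ∀ x b → x ∈ subsets n W →
    when (valid n (linkEnv σ) (x ∷ b)) (∑valid n (suc W) (deletionEnv σ (x ∷ b)) (λ a → h (without1 a ++ with1 (x ∷ b)))) ≡ 0
  vanish x b x∈ = trans (cong (when (valid n (linkEnv σ) (x ∷ b)))
                          (∑valid-link∋ n W σ (x ∷ b) x _ x∈ (here refl) (cong (λ s → step s true) (neg₀ x x∈)) (λ a l → hz a b x l)))
                        (when-zero (valid n (linkEnv σ) (x ∷ b)))

∑valid-singleLink : ∀ n W (σ : Subset (suc n) → Phase) h k → k ∈ subsets n W →
  (∀ C → C ∈ subsets n W → C ≢ k → σ (false ∷ C) ≡ neg) →
  (∀ a b → n ∸ W ≤ length a → b ≢ [] → h (without1 a ++ with1 b) ≡ 0) →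
  ∑valid (suc n) (suc W) σ h ≡ when (valid n (linkEnv σ) []) (∑valid n (suc W) (deletionEnv σ []) (λ a → h (without1 a ++ with1 [])))
                              + when (valid n (linkEnv σ) [ k ]) (∑valid n (suc W) (deletionEnv σ [ k ]) (λ a → h (without1 a ++ with1 [ k ])))
∑valid-singleLink n W σ h k k∈ neg₀ hz =
  trans (∑valid-suc n W σ h) (∑-sublists-unique-support _ (subsets-unique n W) k∈ (λ x b x∈ ne → vanish x (x ∷ b) x∈ ne (here refl))
                                                                                 (λ y b y∈ ne → vanish y (k ∷ y ∷ b) y∈ ne (there (here refl))))
  where
  vanish : ∀ x b → x ∈ subsets n W → x ≢ k → x ∈ b →
    when (valid n (linkEnv σ) b) (∑valid n (suc W) (deletionEnv σ b) (λ a → h (without1 a ++ with1 b))) ≡ 0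
  vanish x b x∈ ne x∈b = trans (cong (when (valid n (linkEnv σ) b))
                                 (∑valid-link∋ n W σ b x _ x∈ x∈b (cong (λ s → step s true) (neg₀ x x∈ ne)) (λ a l → hz a b l (nonempty x∈b))))
                               (when-zero (valid n (linkEnv σ) b))
    where
    nonempty : ∀ {x} {b : List (Subset n)} → x ∈ b → b ≢ []
    nonempty (here _) ()
    nonempty (there _) ()

∑valid-negEnv-shift : ∀ q n W → q + W ≤ n → ∑valid (suc n) (suc W) negEnv (sized q) ≡ ∑valid n (suc W) negEnv (sized q)
∑valid-negEnv-shift q n W le = begin
  ∑valid (suc n) (suc W) negEnv (sized q)
    ≡⟨ ∑valid-emptyLink n W negEnv (sized q) (λ _ _ → refl) (λ a b x l → cong (λ c → when c 1) (length-over-gap q W a (x ∷ b) le l (λ ()))) ⟩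
  when (valid n negEnv []) (∑valid n (suc W) negEnv (λ a → sized q (without1 a ++ [])))
    ≡⟨ cong (λ c → when c (∑valid n (suc W) negEnv (λ a → sized q (without1 a ++ [])))) (valid-[] n negEnv (λ _ → refl)) ⟩
  ∑valid n (suc W) negEnv (λ a → sized q (without1 a ++ with1 []))
    ≡⟨ ∑valid-cong-weight n (suc W) negEnv (λ a → sized-split q a []) ⟩
  ∑valid n (suc W) negEnv (sized q) ∎
  where
  open ≡-Reasoning

subsets-empty : ∀ n W → n < W → subsets n W ≡ []
subsets-empty zero (suc W) p = refl
subsets-empty (suc n) (suc W) (s≤s p) rewrite subsets-empty n W p | subsets-empty n (suc W) (m≤n⇒m≤1+n p) = refl

subsets-full : ∀ n → subsets n n ≡ [ top n n ]
subsets-full zero = refl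
subsets-full (suc n) rewrite subsets-empty n (suc n) ≤-refl | subsets-full n | top-full n = refl

∑valid-full : ∀ n (σ : Subset n → Phase) h → ∑valid n n σ h ≡ when (valid n σ [ top n n ]) (h [ top n n ]) + (when (valid n σ []) (h []) + 0)
∑valid-full n σ h rewrite subsets-full n = refl

-- The top W+1 elements of [n] without the second smallest of them.
nextTop : (n W : ℕ) → Subset n
nextTop zero W = []
nextTop (suc n) W = if suc W ≤ᵇ n then false ∷ nextTop n W else true ∷ top n (pred W)

nextTop-false∷ : ∀ {n W} → suc W ≤ n → nextTop (suc n) W ≡ false ∷ nextTop n W
nextTop-false∷ {n} {W} p rewrite ≤⇒≤ᵇ≡true p = refl

nextTop-gap1 : ∀ W → nextTop (suc (suc W)) (suc W) ≡ true ∷ top (suc W) W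
nextTop-gap1 W rewrite suc≤ᵇ≡false W = refl

valid-top-after-top : ∀ W → valid (suc W) (deletionEnv negEnv [ top (suc W) W ]) [ top (suc W) (suc W) ] ≡ true
valid-top-after-top W rewrite top-false∷ {W} {W} ≤-refl | top-full W =
  trans (valid-suc W _ [ true ∷ top W W ]) (cong₂ _∧_ (negPos-full⇒valid-[] W _ phase) (valid-negEnv-top W W ≤-refl))
  where
  phase : ∀ C → (safe (step (step neg (eqS C (top W W) ∨ false)) (eqS C (top W W) ∨ false)) ≡ true)
              ⊎ ((step (step neg (eqS C (top W W) ∨ false)) (eqS C (top W W) ∨ false) ≡ negPos) × (card C ≡ W))
  phase C with eqS C (top W W) in e
  ... | false = inj₁ refl
  ... | true = inj₂ (refl , trans (cong card (eqS-sound C (top W W) e)) (card-top W W ≤-refl))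

length-gaps-gap1 : ∀ {W} {x : Subset (suc W)} → x ∈ subsets (suc W) W → 0 < length (gaps x)
length-gaps-gap1 {W} x∈ = subst (0 <_) (sym (length-gaps {W = W} x∈)) (m<n⇒0<n∸m {W} ≤-refl)

-- With one free point the deletion is a family of full sets, i.e. [] or [ top ]; a nonempty link
-- leaves a line in phase negPos (or dead) that the empty deletion cannot serve.
∑valid-gap1 : ∀ W (σ : Subset (suc (suc W)) → Phase) h → (∀ C → seenNeg (σ (false ∷ C)) ≡ true) → h [] ≡ 0 →
  ∑valid (suc (suc W)) (suc W) σ h
  ≡ ∑valid (suc W) W (linkEnv σ) (λ b → when (valid (suc W) (deletionEnv σ b) [ top (suc W) (suc W) ]) (h ((false ∷ top (suc W) (suc W)) ∷ with1 b)))
∑valid-gap1 W σ h sn h[] = begin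
  ∑valid (suc n) (suc W) σ h
    ≡⟨ ∑valid-suc n W σ h ⟩
  ∑ bs (λ b → when (valid n (linkEnv σ) b) (∑valid n n (deletionEnv σ b) (λ a → h (without1 a ++ with1 b))))
    ≡⟨ ∑-cong (λ b → cong (when (valid n (linkEnv σ) b)) (trans (∑valid-full n (deletionEnv σ b) (λ a → h (without1 a ++ with1 b)))
                                                                (cong (Top b +_) (+-identityʳ (Empty b))))) bs ⟩
  ∑ bs (λ b → when (valid n (linkEnv σ) b) (Top b + Empty b))
    ≡⟨ trans (∑-cong (λ b → when-+ (valid n (linkEnv σ) b) (Top b) (Empty b)) bs) (∑-+ bs _ _) ⟩
  ∑valid n W (linkEnv σ) Top + ∑valid n W (linkEnv σ) Empty
    ≡⟨ cong (∑valid n W (linkEnv σ) Top +_) (∑-sublists-[] (subsets n W) (λ b → when (valid n (linkEnv σ) b) (Empty b)) emptyOnly) ⟩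
  ∑valid n W (linkEnv σ) Top + when (valid n (linkEnv σ) []) (when (valid n (deletionEnv σ []) []) (h []))
    ≡⟨ cong (λ t → ∑valid n W (linkEnv σ) Top + when (valid n (linkEnv σ) []) (when (valid n (deletionEnv σ []) []) t)) h[] ⟩
  ∑valid n W (linkEnv σ) Top + when (valid n (linkEnv σ) []) (when (valid n (deletionEnv σ []) []) 0)
    ≡⟨ cong (∑valid n W (linkEnv σ) Top +_) (trans (cong (when (valid n (linkEnv σ) [])) (when-zero (valid n (deletionEnv σ []) []))) (when-zero (valid n (linkEnv σ) []))) ⟩
  ∑valid n W (linkEnv σ) Top + 0
    ≡⟨ +-identityʳ _ ⟩
  ∑valid n W (linkEnv σ) Top ∎
  where
  open ≡-Reasoning
  n = suc W
  u = top n n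
  bs = sublists (subsets n W)
  Top Empty : List (Subset n) → ℕ
  Top b = when (valid n (deletionEnv σ b) [ u ]) (h ((false ∷ u) ∷ with1 b))
  Empty b = when (valid n (deletionEnv σ b) []) (h (with1 b))
  when-+ : ∀ c x y → when c (x + y) ≡ when c x + when c y
  when-+ true x y = refl
  when-+ false x y = refl
  emptyOnly : ∀ x b → x ∈ subsets n W → when (valid n (linkEnv σ) (x ∷ b)) (Empty (x ∷ b)) ≡ 0
  emptyOnly x b x∈ rewrite seenNeg-link⇒invalid-[] n σ (x ∷ b) (sn x) (here refl) (length-gaps-gap1 x∈) =
    when-zero (valid n (linkEnv σ) (x ∷ b))

sized-∷-with1 : ∀ {n} q x (b : List (Subset n)) → sized (suc q) (x ∷ with1 b) ≡ sized q b
sized-∷-with1 q x b = cong (λ m → when (suc m ≡ᵇ suc q) 1) (length-map (true ∷_) b)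

∑valid-negEnv-pairs-gap1 : ∀ W (f : List (Subset (suc (suc W))) → ℕ) →
  ∑valid (suc (suc W)) (suc W) negEnv (λ b → when (length b ≡ᵇ 2) (f b)) ≡ f (top (suc (suc W)) (suc W) ∷ nextTop (suc (suc W)) (suc W) ∷ [])
∑valid-negEnv-pairs-gap1 W f = begin
  ∑valid (suc n) (suc W) negEnv (λ b → when (length b ≡ᵇ 2) (f b))
    ≡⟨ ∑valid-gap1 W negEnv (λ b → when (length b ≡ᵇ 2) (f b)) (λ _ → refl) refl ⟩
  ∑valid n W negEnv (λ b → when (V b) (when (length (with1 b) ≡ᵇ 1) (f (u′ ∷ with1 b))))
    ≡⟨ ∑valid-cong-weight n W negEnv (λ b → trans (cong (λ m → when (V b) (when (m ≡ᵇ 1) (f (u′ ∷ with1 b)))) (length-map (true ∷_) b))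
                                                  (when-comm (V b) (length b ≡ᵇ 1) _)) ⟩
  ∑valid n W negEnv (λ b → when (length b ≡ᵇ 1) (when (V b) (f (u′ ∷ with1 b))))
    ≡⟨ ∑valid-negEnv-singles n W (λ b → when (V b) (f (u′ ∷ with1 b))) (n≤1+n W) ⟩
  when (V [ top n W ]) (f (u′ ∷ with1 [ top n W ]))
    ≡⟨ cong (λ c → when c (f (u′ ∷ with1 [ top n W ]))) (valid-top-after-top W) ⟩
  f (u′ ∷ with1 [ top n W ])
    ≡⟨ cong f (cong₂ (λ S T → S ∷ T ∷ []) (sym (top-false∷ {n} {suc W} ≤-refl)) (sym (nextTop-gap1 W))) ⟩
  f (top (suc n) (suc W) ∷ nextTop (suc n) (suc W) ∷ []) ∎
  where
  open ≡-Reasoning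
  n = suc W
  u′ = false ∷ top n n
  V : List (Subset n) → Bool
  V b = valid n (deletionEnv negEnv b) [ top n n ]

∑valid-negEnv-pairs : ∀ n W (f : List (Subset n) → ℕ) → 2 + W ≤ n →
  ∑valid n (suc W) negEnv (λ b → when (length b ≡ᵇ 2) (f b)) ≡ f (top n (suc W) ∷ nextTop n (suc W) ∷ [])
∑valid-negEnv-pairs (suc n) W f (s≤s le) with 2 + W ≤? n
... | yes le′ = begin
  ∑valid (suc n) (suc W) negEnv h
    ≡⟨ ∑valid-emptyLink n W negEnv h (λ _ _ → refl) (λ a b x l → cong (λ c → when c (f (without1 a ++ with1 (x ∷ b)))) (length-over-gap 2 W a (x ∷ b) le′ l (λ ()))) ⟩
  when (valid n negEnv []) (∑valid n (suc W) negEnv (λ a → h (without1 a ++ [])))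
    ≡⟨ cong (λ c → when c (∑valid n (suc W) negEnv (λ a → h (without1 a ++ [])))) (valid-[] n negEnv (λ _ → refl)) ⟩
  ∑valid n (suc W) negEnv (λ a → h (without1 a ++ []))
    ≡⟨ ∑valid-cong-weight n (suc W) negEnv (λ a → cong₂ (λ c L → when c (f L)) (cong (_≡ᵇ 2) (length-split a [])) (++-identityʳ (without1 a))) ⟩
  ∑valid n (suc W) negEnv (λ a → when (length a + 0 ≡ᵇ 2) (f (without1 a)))
    ≡⟨ ∑valid-cong-weight n (suc W) negEnv (λ a → cong (λ m → when (m ≡ᵇ 2) (f (without1 a))) (+-identityʳ (length a))) ⟩
  ∑valid n (suc W) negEnv (λ a → when (length a ≡ᵇ 2) (f (without1 a)))
    ≡⟨ ∑valid-negEnv-pairs n W (f ∘ without1) le′ ⟩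
  f (without1 (top n (suc W) ∷ nextTop n (suc W) ∷ []))
    ≡⟨ cong f (cong₂ (λ S T → S ∷ T ∷ []) (sym (top-false∷ (≤-trans (n≤1+n _) le′))) (sym (nextTop-false∷ le′))) ⟩
  f (top (suc n) (suc W) ∷ nextTop (suc n) (suc W) ∷ []) ∎
  where
  open ≡-Reasoning
  h : List (Subset (suc n)) → ℕ
  h b = when (length b ≡ᵇ 2) (f b)

∑valid-negEnv-pairs (suc n) W f (s≤s le) | no ¬le′ with ≤-antisym le (≮⇒≥ ¬le′)
...   | refl = ∑valid-negEnv-pairs-gap1 W f

count-negEnv-2 : ∀ n W → 2 + W ≤ n → ∑valid n (suc W) negEnv (sized 2) ≡ 1
count-negEnv-2 n W le = ∑valid-negEnv-pairs n W (λ _ → 1) le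

valid-top-after-pair : ∀ W →
  valid (suc (suc W)) (deletionEnv negEnv (top (suc (suc W)) (suc W) ∷ nextTop (suc (suc W)) (suc W) ∷ [])) [ top (suc (suc W)) (suc (suc W)) ] ≡ true
valid-top-after-pair W rewrite top-false∷ {suc W} {suc W} ≤-refl | nextTop-gap1 W | top-full (suc W) =
  trans (valid-suc n σ [ true ∷ v ]) (cong₂ _∧_ (negPos-full⇒valid-[] n _ phase) (valid-top-after-top W))
  where
  n = suc W
  v = top n n
  σ : Subset (suc n) → Phase
  σ = deletionEnv negEnv ((false ∷ v) ∷ (true ∷ top n W) ∷ [])
  phase : ∀ C → (safe (deletionEnv σ [ v ] C) ≡ true) ⊎ ((deletionEnv σ [ v ] C ≡ negPos) × (card C ≡ n))
  phase C with eqS C v in e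
  ... | false = inj₁ refl
  ... | true = inj₂ (refl , trans (cong card (eqS-sound C v e)) (card-top n n ≤-refl))

∑valid-pairs-after-top : ∀ W → ∑valid (suc (suc W)) (suc W) (deletionEnv negEnv [ top (suc (suc W)) W ]) (sized 2) ≡ 1
∑valid-pairs-after-top W rewrite top-false∷ {suc W} {W} (n≤1+n W) = begin
  ∑valid (suc n) (suc W) σ (sized 2)
    ≡⟨ ∑valid-gap1 W σ (sized 2) seen refl ⟩
  ∑valid n W negEnv (λ b → when (V b) (sized 2 ((false ∷ top n n) ∷ with1 b)))
    ≡⟨ ∑valid-cong-weight n W negEnv (λ b → trans (cong (when (V b)) (sized-∷-with1 1 (false ∷ top n n) b)) (when-comm (V b) (length b ≡ᵇ 1) 1)) ⟩
  ∑valid n W negEnv (λ b → when (length b ≡ᵇ 1) (when (V b) 1))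
    ≡⟨ ∑valid-negEnv-singles n W (λ b → when (V b) 1) (n≤1+n W) ⟩
  when (V [ y₀ ]) 1
    ≡⟨ cong (λ c → when c 1) (trans (valid-cong-env n [ top n n ] sameEnv) (valid-top-after-top W)) ⟩
  1 ∎
  where
  open ≡-Reasoning
  n = suc W
  y₀ = top n W
  σ : Subset (suc n) → Phase
  σ = deletionEnv negEnv [ false ∷ y₀ ]
  V : List (Subset n) → Bool
  V b = valid n (deletionEnv σ b) [ top n n ]
  seen : ∀ C → seenNeg (σ (false ∷ C)) ≡ true
  seen C with eqS C y₀
  ... | true = refl
  ... | false = refl
  sameEnv : ∀ C → deletionEnv σ [ y₀ ] C ≡ deletionEnv negEnv [ y₀ ] C
  sameEnv C with eqS C y₀
  ... | true = refl
  ... | false = refl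

count-negEnv-3-gap1 : ∀ W → ∑valid (suc (suc W)) (suc W) negEnv (sized 3) ≡ 1 ⊓ W
count-negEnv-3-gap1 W = begin
  ∑valid (suc n) (suc W) negEnv (sized 3)
    ≡⟨ ∑valid-gap1 W negEnv (sized 3) (λ _ → refl) refl ⟩
  ∑valid n W negEnv (λ b → when (V W b) (sized 3 ((false ∷ top n n) ∷ with1 b)))
    ≡⟨ ∑valid-cong-weight n W negEnv (λ b → trans (cong (when (V W b)) (sized-∷-with1 2 (false ∷ top n n) b)) (when-comm (V W b) (length b ≡ᵇ 2) 1)) ⟩
  ∑valid n W negEnv (λ b → when (length b ≡ᵇ 2) (when (V W b) 1))
    ≡⟨ pairs W ⟩
  1 ⊓ W ∎
  where
  open ≡-Reasoning
  n = suc W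
  V : ∀ W → List (Subset (suc W)) → Bool
  V W b = valid (suc W) (deletionEnv negEnv b) [ top (suc W) (suc W) ]
  pairs : ∀ W → ∑valid (suc W) W negEnv (λ b → when (length b ≡ᵇ 2) (when (V W b) 1)) ≡ 1 ⊓ W
  pairs zero = refl
  pairs (suc W) = trans (∑valid-negEnv-pairs (suc (suc W)) W _ ≤-refl) (cong (λ c → when c 1) (valid-top-after-pair W))

count-negEnv-3-gap2 : ∀ W → ∑valid (suc (suc (suc W))) (suc W) negEnv (sized 3) ≡ suc (1 ⊓ W)
count-negEnv-3-gap2 W = begin
  ∑valid (suc n) (suc W) negEnv (sized 3)
    ≡⟨ ∑valid-suc n W negEnv (sized 3) ⟩
  ∑ (sublists (subsets n W)) Term
    ≡⟨ ∑-sublists-≤1 (subsets n W) Term vanish ⟩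
  Term [] + ∑ (subsets n W) (Term ∘ [_])
    ≡⟨ cong₂ _+_ noLink oneLink ⟩
  1 ⊓ W + 1
    ≡⟨ +-comm (1 ⊓ W) 1 ⟩
  suc (1 ⊓ W) ∎
  where
  open ≡-Reasoning
  n = suc (suc W)
  Term : List (Subset n) → ℕ
  Term b = when (valid n negEnv b) (∑valid n (suc W) (deletionEnv negEnv b) (λ a → sized 3 (without1 a ++ with1 b)))
  vanish : ∀ x y b → x ∈ subsets n W → Term (x ∷ y ∷ b) ≡ 0
  vanish x y b x∈ = trans (cong (when (valid n negEnv (x ∷ y ∷ b)))
                             (∑valid-link∋ n W negEnv (x ∷ y ∷ b) x _ x∈ (here refl) refl
                               (λ a l → cong (λ c → when c 1)
                                          (length-split-over 3 a (x ∷ y ∷ b) (+-mono-≤ (subst (_≤ length a) (m+n∸n≡m 2 W) l) (s≤s (s≤s z≤n)))))))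
                          (when-zero (valid n negEnv (x ∷ y ∷ b)))
  noLink : Term [] ≡ 1 ⊓ W
  noLink = trans (cong (λ c → when c (∑valid n (suc W) negEnv (λ a → sized 3 (without1 a ++ [])))) (valid-[] n negEnv (λ _ → refl)))
                 (trans (∑valid-cong-weight n (suc W) negEnv (λ a → sized-split 3 a [])) (count-negEnv-3-gap1 W))
  oneLink : ∑ (subsets n W) (Term ∘ [_]) ≡ 1
  oneLink = trans (∑-cong (λ y → cong (when (valid n negEnv [ y ])) (∑valid-cong-weight n (suc W) (deletionEnv negEnv [ y ]) (λ a → sized-split 2 a [ y ]))) (subsets n W))
                  (trans (∑-valid-negEnv-single n W (λ y → ∑valid n (suc W) (deletionEnv negEnv [ y ]) (sized 2)) (≤-trans (n≤1+n W) (n≤1+n (suc W))))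
                         (∑valid-pairs-after-top W))

count-negEnv-3 : ∀ n W → 3 + W ≤ n → ∑valid n (suc W) negEnv (sized 3) ≡ suc (1 ⊓ W)
count-negEnv-3 (suc n) W (s≤s le) with 3 + W ≤? n
... | yes le′ = trans (∑valid-negEnv-shift 3 n W le′) (count-negEnv-3 n W le′)
... | no ¬le′ with ≤-antisym le (≮⇒≥ ¬le′)
...   | refl = count-negEnv-3-gap2 W

-- Links of one or two sets

-- Lines avoiding element 1 start with the sign contributed by the link A.
after : ∀ {n} → List (Subset n) → Subset n → Phase
after = deletionEnv fresh

safe-after : ∀ {n} (A : List (Subset n)) C → safe (after A C) ≡ true
safe-after A C with τ A C
... | true = refl
... | false = refl

length-gaps-pos : ∀ {n W x} → x ∈ subsets n W → W < n → 0 < length (gaps x)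
length-gaps-pos {n} {W} x∈ W<n = subst (0 <_) (sym (length-gaps {W = W} x∈)) (m<n⇒0<n∸m W<n)

∑-split : ∀ {n} (A B : List (Subset n)) (g : Subset (suc n) → ℕ) → ∑ (without1 A ++ with1 B) g ≡ ∑ A (g ∘ (false ∷_)) + ∑ B (g ∘ (true ∷_))
∑-split A B g = trans (∑-++ (without1 A) (with1 B) g) (cong₂ _+_ (∑-map (false ∷_) A g) (∑-map (true ∷_) B g))

valid-single-false∷ : ∀ n (σ : Subset (suc n) → Phase) x → (∀ C → safe (linkEnv σ C) ≡ true) →
  valid (suc n) σ [ false ∷ x ] ≡ valid n (deletionEnv σ []) [ x ]
valid-single-false∷ n σ x sf = trans (valid-suc n σ [ false ∷ x ]) (trans (cong (valid n (deletionEnv σ []) [ x ] ∧_) (valid-[] n (linkEnv σ) sf)) (∧-identityʳ _))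

valid-single-true∷ : ∀ n (σ : Subset (suc n) → Phase) x →
  valid (suc n) σ [ true ∷ x ] ≡ (valid n (deletionEnv σ [ x ]) [] ∧ valid n (linkEnv σ) [ x ])
valid-single-true∷ n σ x = valid-suc n σ [ true ∷ x ]

deletionEnv-self-negPos : ∀ {n} (σ : Subset (suc n) → Phase) x → σ (false ∷ x) ≡ neg → deletionEnv σ [ x ] x ≡ negPos
deletionEnv-self-negPos σ x e rewrite e | eqS-refl x = refl

seenNeg-after-minus : ∀ {n} (k C : Subset n) → seenNeg (deletionEnv (after {suc n} [ false ∷ k ]) [] C) ≡ true
seenNeg-after-minus k C with eqS C k
... | true = refl
... | false = refl

posNeg-after-minus : ∀ {n} (k : Subset n) → deletionEnv (after {suc n} [ false ∷ k ]) [] k ≡ posNeg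
posNeg-after-minus k rewrite eqS-refl k = refl

∑-valid-after-plus : ∀ n W (y : Subset n) (g : Subset (suc n) → ℕ) → W < n →
  ∑ (subsets (suc n) (suc W)) (λ x → when (valid (suc n) (after [ true ∷ y ]) [ x ]) (g x)) ≡ g (false ∷ top n (suc W))
∑-valid-after-plus n W y g W<n = trans (∑-split (subsets n (suc W)) (subsets n W) _) (trans (cong₂ _+_ avoid1 through1) (+-identityʳ _))
  where
  σ = after {suc n} [ true ∷ y ]
  avoid1 : ∑ (subsets n (suc W)) (λ x → when (valid (suc n) σ [ false ∷ x ]) (g (false ∷ x))) ≡ g (false ∷ top n (suc W))
  avoid1 = trans (∑-cong (λ x → cong (λ c → when c (g (false ∷ x))) (valid-single-false∷ n σ x (safe-after [ y ]))) (subsets n (suc W)))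
                 (∑-valid-negEnv-single n (suc W) (g ∘ (false ∷_)) W<n)
  through1 : ∑ (subsets n W) (λ x → when (valid (suc n) σ [ true ∷ x ]) (g (true ∷ x))) ≡ 0
  through1 = ∑-zero (subsets n W) (λ x x∈ → cong (λ c → when c (g (true ∷ x)))
    (trans (valid-single-true∷ n σ x) (cong (_∧ valid n (linkEnv σ) [ x ]) (negPos-nonfull⇒invalid-[] n _ x (deletionEnv-self-negPos σ x refl) (length-gaps-pos x∈ W<n)))))

∑-valid-after-minus-top : ∀ n W (g : Subset (suc n) → ℕ) → W < n →
  ∑ (subsets (suc n) (suc W)) (λ x → when (valid (suc n) (after [ false ∷ top n W ]) [ x ]) (g x)) ≡ g (true ∷ top n W)
∑-valid-after-minus-top n W g W<n = trans (∑-split (subsets n (suc W)) (subsets n W) _) (cong₂ _+_ avoid1 through1)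
  where
  k = top n W
  σ = after {suc n} [ false ∷ k ]
  avoid1 : ∑ (subsets n (suc W)) (λ x → when (valid (suc n) σ [ false ∷ x ]) (g (false ∷ x))) ≡ 0
  avoid1 = ∑-zero (subsets n (suc W)) (λ x x∈ → cong (λ c → when c (g (false ∷ x)))
    (trans (valid-suc n σ [ false ∷ x ]) (cong (_∧ valid n (linkEnv σ) []) (posNeg-top⇒invalid n W _ [ x ] W<n (seenNeg-after-minus k) (posNeg-after-minus k) (λ ())
       (λ { S (here refl) → ∈-subsets⇒card x∈ })))))
  safe-k : ∀ C → safe (deletionEnv σ [ k ] C) ≡ true
  safe-k C with eqS C k
  ... | true = refl
  ... | false = refl
  through1 : ∑ (subsets n W) (λ x → when (valid (suc n) σ [ true ∷ x ]) (g (true ∷ x))) ≡ g (true ∷ k)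
  through1 = trans (∑-unique-support _ (subsets-unique n W) (top∈subsets n W (≤-trans (n≤1+n W) W<n)) off)
                   (cong (λ c → when c (g (true ∷ k))) (trans (valid-single-true∷ n σ k)
                     (cong₂ _∧_ (valid-[] n _ safe-k) (valid-negEnv-top n W (≤-trans (n≤1+n W) W<n)))))
    where
    off : ∀ x → x ∈ subsets n W → x ≢ k → when (valid (suc n) σ [ true ∷ x ]) (g (true ∷ x)) ≡ 0
    off x x∈ ne rewrite valid-single-true∷ n σ x with valid n negEnv [ x ] in v
    ... | true = ⊥-elim (ne (valid-negEnv-single⇒top n W x (∈-subsets⇒card x∈) v))
    ... | false with valid n (deletionEnv σ [ x ]) []
    ...   | true = refl
    ...   | false = refl

singles-after-plus : ∀ m W (y : Subset m) → W < m → ∑valid (suc m) (suc W) (after [ true ∷ y ]) (sized 1) ≡ 1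
singles-after-plus m W y lt = trans (∑valid-singles (suc m) (suc W) _ (λ _ → 1)) (∑-valid-after-plus m W y (λ _ → 1) lt)

singles-after-minus-top : ∀ m W → W < m → ∑valid (suc m) (suc W) (after [ false ∷ top m W ]) (sized 1) ≡ 1
singles-after-minus-top m W lt = trans (∑valid-singles (suc m) (suc W) _ (λ _ → 1)) (∑-valid-after-minus-top m W (λ _ → 1) lt)

pairs-after-plus : ∀ n W (y : Subset n) → 2 + W ≤ n → ∑valid (suc n) (suc W) (after [ true ∷ y ]) (sized 2) ≡ 1
pairs-after-plus n W y le = begin
  ∑valid (suc n) (suc W) σ (sized 2)
    ≡⟨ ∑valid-emptyLink n W σ (sized 2) (λ _ _ → refl) (λ a b x l → cong (λ c → when c 1) (length-over-gap 2 W a (x ∷ b) le l (λ ()))) ⟩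
  when (valid n (linkEnv σ) []) (∑valid n (suc W) negEnv (λ a → sized 2 (without1 a ++ [])))
    ≡⟨ cong (λ c → when c (∑valid n (suc W) negEnv (λ a → sized 2 (without1 a ++ [])))) (valid-[] n (linkEnv σ) (safe-after [ y ])) ⟩
  ∑valid n (suc W) negEnv (λ a → sized 2 (without1 a ++ with1 []))
    ≡⟨ ∑valid-cong-weight n (suc W) negEnv (λ a → sized-split 2 a []) ⟩
  ∑valid n (suc W) negEnv (sized 2)
    ≡⟨ count-negEnv-2 n W le ⟩
  1 ∎
  where
  open ≡-Reasoning
  σ = after {suc n} [ true ∷ y ]

pairs-after-minus-top : ∀ n W → 2 + W ≤ n → ∑valid (suc n) (suc W) (after [ false ∷ top n W ]) (sized 2) ≡ 1
pairs-after-minus-top (suc m) W le = begin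
  ∑valid (suc n) (suc W) σ (sized 2)
    ≡⟨ ∑valid-singleLink n W σ (sized 2) k (top∈subsets n W W≤n) neg₀ (λ a b l ne → cong (λ c → when c 1) (length-over-gap 2 W a b le l ne)) ⟩
  when (valid n negEnv []) (∑valid n (suc W) (deletionEnv σ []) (λ a → sized 2 (without1 a ++ [])))
    + when (valid n negEnv [ k ]) (∑valid n (suc W) (deletionEnv σ [ k ]) (λ a → sized 2 (without1 a ++ with1 [ k ])))
    ≡⟨ cong₂ _+_ noLink oneLink ⟩
  0 + 1 ∎
  where
  open ≡-Reasoning
  n = suc m
  k = top n W
  σ = after {suc n} [ false ∷ k ]
  W≤n : W ≤ n
  W≤n = ≤-trans (m≤n+m W 2) le
  neg₀ : ∀ C → C ∈ subsets n W → C ≢ k → σ (false ∷ C) ≡ neg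
  neg₀ C _ ne rewrite eqS-≢ ne = refl
  noLink : when (valid n negEnv []) (∑valid n (suc W) (deletionEnv σ []) (λ a → sized 2 (without1 a ++ []))) ≡ 0
  noLink = trans (cong (when (valid n negEnv [])) (∑valid-posNeg-top n W _ _ (≤-trans (n≤1+n (suc W)) le) (seenNeg-after-minus k) (posNeg-after-minus k) refl))
                 (when-zero (valid n negEnv []))
  sameEnv : ∀ C → deletionEnv σ [ k ] C ≡ after [ k ] C
  sameEnv C with eqS C k
  ... | true = refl
  ... | false = refl
  oneLink : when (valid n negEnv [ k ]) (∑valid n (suc W) (deletionEnv σ [ k ]) (λ a → sized 2 (without1 a ++ with1 [ k ]))) ≡ 1
  oneLink = begin
    when (valid n negEnv [ k ]) (∑valid n (suc W) (deletionEnv σ [ k ]) (λ a → sized 2 (without1 a ++ with1 [ k ])))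
      ≡⟨ cong (λ c → when c (∑valid n (suc W) (deletionEnv σ [ k ]) (λ a → sized 2 (without1 a ++ with1 [ k ])))) (valid-negEnv-top n W W≤n) ⟩
    ∑valid n (suc W) (deletionEnv σ [ k ]) (λ a → sized 2 (without1 a ++ with1 [ k ]))
      ≡⟨ trans (∑valid-cong-weight n (suc W) (deletionEnv σ [ k ]) (λ a → sized-split 1 a [ k ])) (∑valid-cong-env n (suc W) (sized 1) sameEnv) ⟩
    ∑valid n (suc W) (after [ k ]) (sized 1)
      ≡⟨ cong (λ y → ∑valid n (suc W) (after [ y ]) (sized 1)) (top-false∷ (≤-trans (n≤1+n W) (≤-pred le))) ⟩
    ∑valid n (suc W) (after [ false ∷ top m W ]) (sized 1)
      ≡⟨ singles-after-minus-top m W (≤-pred le) ⟩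
    1 ∎

∑-valid-fresh-single-zero : ∀ m (g : Subset (suc m) → ℕ) →
  ∑ (subsets (suc m) 0) (λ y → when (valid (suc m) fresh [ y ]) (g y)) ≡ g (false ∷ top m 0)
∑-valid-fresh-single-zero m g = trans (∑-map (false ∷_) (subsets m 0) _)
  (trans (∑-cong (λ y → cong (λ c → when c (g (false ∷ y))) (valid-single-false∷ m fresh y (λ _ → refl))) (subsets m 0))
         (∑-valid-negEnv-single m 0 (g ∘ (false ∷_)) z≤n))

∑-valid-fresh-single-suc : ∀ m W (g : Subset (suc m) → ℕ) → W < m →
  ∑ (subsets (suc m) (suc W)) (λ y → when (valid (suc m) fresh [ y ]) (g y))
  ≡ g (false ∷ top m (suc W)) + ∑ (subsets m W) (λ y → when (valid m fresh [ y ]) (g (true ∷ y)))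
∑-valid-fresh-single-suc m W g W<m = trans (∑-split (subsets m (suc W)) (subsets m W) _) (cong₂ _+_ avoid1 through1)
  where
  avoid1 = trans (∑-cong (λ y → cong (λ c → when c (g (false ∷ y))) (valid-single-false∷ m fresh y (λ _ → refl))) (subsets m (suc W)))
                 (∑-valid-negEnv-single m (suc W) (g ∘ (false ∷_)) W<m)
  through1 = ∑-cong (λ y → cong (λ c → when c (g (true ∷ y)))
    (trans (valid-single-true∷ m fresh y) (cong (_∧ valid m fresh [ y ]) (valid-[] m (after [ y ]) (safe-after [ y ]))))) (subsets m W)

count-fresh-single : ∀ n W → W < n → ∑ (subsets n W) (λ y → when (valid n fresh [ y ]) 1) ≡ suc W
count-fresh-single (suc m) zero le = ∑-valid-fresh-single-zero m (λ _ → 1)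
count-fresh-single (suc m) (suc W) le =
  trans (∑-valid-fresh-single-suc m W (λ _ → 1) (≤-pred le)) (cong suc (count-fresh-single m W (≤-pred le)))

∑-single-then-single : ∀ n W → 2 + W ≤ n →
  ∑ (subsets n W) (λ y → when (valid n fresh [ y ]) (∑valid n (suc W) (after [ y ]) (sized 1))) ≡ suc W
∑-single-then-single (suc m) zero le =
  trans (∑-valid-fresh-single-zero m _) (singles-after-minus-top m 0 (≤-pred le))
∑-single-then-single (suc m) (suc W) le =
  trans (∑-valid-fresh-single-suc m W _ W<m)
        (cong₂ _+_ (singles-after-minus-top m (suc W) (≤-pred le))
                   (trans (∑-cong (λ y → cong (when (valid m fresh [ y ])) (singles-after-plus m (suc W) y (≤-pred le))) (subsets m W))
                          (count-fresh-single m W W<m)))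
  where
  W<m : W < m
  W<m = ≤-trans (n≤1+n _) (≤-pred le)

∑-single-then-pair : ∀ n W → 3 + W ≤ n →
  ∑ (subsets n W) (λ y → when (valid n fresh [ y ]) (∑valid n (suc W) (after [ y ]) (sized 2))) ≡ suc W
∑-single-then-pair (suc m) zero le = trans (∑-valid-fresh-single-zero m _) (pairs-after-minus-top m 0 (≤-pred le))
∑-single-then-pair (suc m) (suc W) le =
  trans (∑-valid-fresh-single-suc m W _ W<m)
        (cong₂ _+_ (pairs-after-minus-top m (suc W) (≤-pred le))
                   (trans (∑-cong (λ y → cong (when (valid m fresh [ y ])) (pairs-after-plus m (suc W) y (≤-pred le))) (subsets m W))
                          (count-fresh-single m W W<m)))
  where
  W<m : W < m
  W<m = ≤-trans (n≤1+n _) (≤-trans (n≤1+n _) (≤-pred le))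

-- The line through x has read plus then minus; every other line has read a minus.
posNegAt : ∀ {n} → Subset n → Subset n → Phase
posNegAt x C = step (step start (eqS C x ∨ false)) false

seenNeg-posNegAt : ∀ {n} (x C : Subset n) → seenNeg (posNegAt x C) ≡ true
seenNeg-posNegAt x C with eqS C x
... | true = refl
... | false = refl

singles-posNegAt : ∀ m V → Subset m → ℕ
singles-posNegAt m V x = ∑ (subsets m V) (λ s → when (valid m (posNegAt x) [ s ]) 1)

singles-posNegAt-top : ∀ m W → 2 + W ≤ m → singles-posNegAt m (2 + W) (top m (suc W)) ≡ 0
singles-posNegAt-top m W le = ∑-zero (subsets m (2 + W)) (λ s s∈ → cong (λ c → when c 1)
  (posNeg-top⇒invalid m (suc W) (posNegAt (top m (suc W))) [ s ] le (seenNeg-posNegAt _) x-posNeg (λ ())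
    (λ { S (here refl) → ∈-subsets⇒card s∈ })))
  where
  x-posNeg : posNegAt (top m (suc W)) (top m (suc W)) ≡ posNeg
  x-posNeg rewrite eqS-refl (top m (suc W)) = refl

singles-posNegAt-plusTop : ∀ m W → 2 + W ≤ m → singles-posNegAt (suc m) (2 + W) (true ∷ top m W) ≡ 1
singles-posNegAt-plusTop m W le = trans (∑-split (subsets m (2 + W)) (subsets m (suc W)) _) (trans (cong₂ _+_ avoid1 through1) (+-identityʳ 1))
  where
  x = true ∷ top m W
  avoid1 : ∑ (subsets m (2 + W)) (λ s → when (valid (suc m) (posNegAt x) [ false ∷ s ]) 1) ≡ 1
  avoid1 = trans (∑-cong (λ s → cong (λ c → when c 1) (valid-single-false∷ m (posNegAt x) s safe-link)) (subsets m (2 + W)))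
                 (∑-valid-negEnv-single m (2 + W) (λ _ → 1) le)
    where
    safe-link : ∀ C → safe (linkEnv (posNegAt x) C) ≡ true
    safe-link C with eqS C (top m W)
    ... | true = refl
    ... | false = refl
  through1 : ∑ (subsets m (suc W)) (λ s → when (valid (suc m) (posNegAt x) [ true ∷ s ]) 1) ≡ 0
  through1 = ∑-zero (subsets m (suc W)) (λ s s∈ → cong (λ c → when c 1)
    (trans (valid-single-true∷ m (posNegAt x) s)
           (cong (_∧ valid m (linkEnv (posNegAt x)) [ s ]) (negPos-nonfull⇒invalid-[] m _ s (deletionEnv-self-negPos (posNegAt x) s refl) (length-gaps-pos s∈ le)))))

singles-after-cross : ∀ m W (x y : Subset m) → x ∈ subsets m (suc W) → suc W < m →
  ∑valid (suc m) (2 + W) (after ((false ∷ x) ∷ (true ∷ y) ∷ [])) (sized 1) ≡ singles-posNegAt m (2 + W) x + when (valid m (after [ y ]) [ x ]) 1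
singles-after-cross m W x y x∈ lt = trans (∑valid-singles (suc m) (2 + W) σ (λ _ → 1)) (trans (∑-split (subsets m (2 + W)) (subsets m (suc W)) _) (cong₂ _+_ avoid1 through1))
  where
  σ = after {suc m} ((false ∷ x) ∷ (true ∷ y) ∷ [])
  avoid1 : ∑ (subsets m (2 + W)) (λ s → when (valid (suc m) σ [ false ∷ s ]) 1) ≡ singles-posNegAt m (2 + W) x
  avoid1 = ∑-cong (λ s → cong (λ c → when c 1) (valid-single-false∷ m σ s (safe-after [ y ]))) (subsets m (2 + W))
  safe-x : ∀ C → safe (deletionEnv σ [ x ] C) ≡ true
  safe-x C with eqS C x
  ... | true = refl
  ... | false = refl
  through1 : ∑ (subsets m (suc W)) (λ s → when (valid (suc m) σ [ true ∷ s ]) 1) ≡ when (valid m (after [ y ]) [ x ]) 1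
  through1 = trans (∑-unique-support _ (subsets-unique m (suc W)) x∈ off)
                   (cong (λ c → when c 1) (trans (valid-single-true∷ m σ x) (cong (_∧ valid m (after [ y ]) [ x ]) (valid-[] m _ safe-x))))
    where
    off : ∀ s → s ∈ subsets m (suc W) → s ≢ x → when (valid (suc m) σ [ true ∷ s ]) 1 ≡ 0
    off s s∈ ne = cong (λ c → when c 1) (trans (valid-single-true∷ m σ s)
      (cong (_∧ valid m (linkEnv σ) [ s ]) (negPos-nonfull⇒invalid-[] m _ s s-negPos (length-gaps-pos s∈ lt))))
      where
      s-negPos : deletionEnv σ [ s ] s ≡ negPos
      s-negPos rewrite eqS-≢ ne | eqS-refl s = refl

singles-after-deletedPair : ∀ m W → suc W < m →
  ∑valid (suc m) (2 + W) (after (without1 (top m (suc W) ∷ nextTop m (suc W) ∷ []))) (sized 1) ≡ 1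
singles-after-deletedPair m W lt = trans (∑valid-singles (suc m) (2 + W) σ (λ _ → 1)) (trans (∑-split (subsets m (2 + W)) (subsets m (suc W)) _) (cong₂ _+_ avoid1 through1))
  where
  k = top m (suc W)
  k′ = nextTop m (suc W)
  σ = after {suc m} (without1 (k ∷ k′ ∷ []))
  seen : ∀ C → seenNeg (deletionEnv σ [] C) ≡ true
  seen C with eqS C k | eqS C k′
  ... | true | _ = refl
  ... | false | true = refl
  ... | false | false = refl
  k-posNeg : deletionEnv σ [] k ≡ posNeg
  k-posNeg rewrite eqS-refl k = refl
  avoid1 : ∑ (subsets m (2 + W)) (λ s → when (valid (suc m) σ [ false ∷ s ]) 1) ≡ 0
  avoid1 = ∑-zero (subsets m (2 + W)) (λ s s∈ → cong (λ c → when c 1)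
    (trans (valid-suc m σ [ false ∷ s ]) (cong (_∧ valid m (linkEnv σ) []) (posNeg-top⇒invalid m (suc W) _ [ s ] lt seen k-posNeg (λ ())
       (λ { S (here refl) → ∈-subsets⇒card s∈ })))))
  safe-k : ∀ C → safe (deletionEnv σ [ k ] C) ≡ true
  safe-k C with eqS C k | eqS C k′
  ... | true | _ = refl
  ... | false | true = refl
  ... | false | false = refl
  through1 : ∑ (subsets m (suc W)) (λ s → when (valid (suc m) σ [ true ∷ s ]) 1) ≡ 1
  through1 = trans (∑-unique-support _ (subsets-unique m (suc W)) (top∈subsets m (suc W) (≤-trans (n≤1+n _) lt)) off)
                   (cong (λ c → when c 1) (trans (valid-single-true∷ m σ k) (cong₂ _∧_ (valid-[] m _ safe-k) (valid-negEnv-top m (suc W) (≤-trans (n≤1+n _) lt)))))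
    where
    off : ∀ s → s ∈ subsets m (suc W) → s ≢ k → when (valid (suc m) σ [ true ∷ s ]) 1 ≡ 0
    off s s∈ ne rewrite valid-single-true∷ m σ s with valid m negEnv [ s ] in v
    ... | true = ⊥-elim (ne (valid-negEnv-single⇒top m (suc W) s (∈-subsets⇒card s∈) v))
    ... | false with valid m (deletionEnv σ [ s ]) []
    ...   | true = refl
    ...   | false = refl

deletion-pre1 : ∀ {n} (b : List (Subset n)) → deletion (with1 b) ≡ []
deletion-pre1 [] = refl
deletion-pre1 (x ∷ b) = deletion-pre1 b

singles-after-linked : ∀ m W (b : List (Subset m)) → W < m → ∑valid (suc m) (suc W) (after (with1 b)) (sized 1) ≡ 1
singles-after-linked m W b lt = begin
  ∑valid (suc m) (suc W) σ (sized 1)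
    ≡⟨ ∑valid-emptyLink m W σ (sized 1) neg₀ (λ a b′ x l → cong (λ c → when c 1) (length-over-gap 1 W a (x ∷ b′) lt l (λ ()))) ⟩
  when (valid m (linkEnv σ) []) (∑valid m (suc W) (deletionEnv σ []) (λ a → sized 1 (without1 a ++ [])))
    ≡⟨ cong (λ c → when c (∑valid m (suc W) (deletionEnv σ []) (λ a → sized 1 (without1 a ++ [])))) (valid-[] m (linkEnv σ) (λ C → safe-after (with1 b) (true ∷ C))) ⟩
  ∑valid m (suc W) (deletionEnv σ []) (λ a → sized 1 (without1 a ++ with1 []))
    ≡⟨ ∑valid-cong-weight m (suc W) (deletionEnv σ []) (λ a → sized-split 1 a []) ⟩
  ∑valid m (suc W) (deletionEnv σ []) (sized 1)
    ≡⟨ ∑valid-cong-env m (suc W) (sized 1) (λ C → cong (λ c → step (step start c) false) (τ-avoid1 C)) ⟩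
  ∑valid m (suc W) negEnv (sized 1)
    ≡⟨ ∑valid-negEnv-sized1 m (suc W) lt ⟩
  1 ∎
  where
  open ≡-Reasoning
  σ = after {suc m} (with1 b)
  τ-avoid1 : ∀ C → τ (with1 b) (false ∷ C) ≡ false
  τ-avoid1 C = trans (τ-deletion (with1 b) C) (cong (λ L → τ L C) (deletion-pre1 b))
  neg₀ : ∀ C → C ∈ subsets m W → σ (false ∷ C) ≡ neg
  neg₀ C _ = cong (step start) (τ-avoid1 C)

∑-pairs-split : ∀ {n} (A B : List (Subset n)) (F : List (Subset (suc n)) → ℕ) →
  ∑ (sublists (without1 A ++ with1 B)) (λ b → when (length b ≡ᵇ 2) (F b))
  ≡ ∑ (sublists A) (λ a → when (length a ≡ᵇ 2) (F (without1 a)))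
    + (∑ A (λ x → ∑ B (λ y → F ((false ∷ x) ∷ (true ∷ y) ∷ [])))
    + ∑ (sublists B) (λ b → when (length b ≡ᵇ 2) (F (with1 b))))
∑-pairs-split {n} A B F = begin
  ∑ (sublists (without1 A ++ with1 B)) h
    ≡⟨ ∑-sublists-++ (without1 A) (with1 B) h ⟩
  ∑ (sublists (without1 A)) (λ a → ∑ (sublists (with1 B)) (λ b → h (a ++ b)))
    ≡⟨ cong (λ L → ∑ L (λ a → ∑ (sublists (with1 B)) (λ b → h (a ++ b)))) (sublists-map (false ∷_) A) ⟩
  ∑ (map without1 (sublists A)) (λ a → ∑ (sublists (with1 B)) (λ b → h (a ++ b)))
    ≡⟨ ∑-map without1 (sublists A) _ ⟩
  ∑ (sublists A) (λ a → ∑ (sublists (with1 B)) (λ b → h (without1 a ++ b)))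
    ≡⟨ ∑-cong (λ a → trans (cong (λ L → ∑ L (λ b → h (without1 a ++ b))) (sublists-map (true ∷_) B)) (∑-map with1 (sublists B) _)) (sublists A) ⟩
  ∑ (sublists A) (λ a → ∑ (sublists B) (λ b → h (without1 a ++ with1 b)))
    ≡⟨ ∑-cong byDeletionSize (sublists A) ⟩
  ∑ (sublists A) (λ a → when (length a ≡ᵇ 2) (F (without1 a)) + (when (length a ≡ᵇ 1) (Cross a) + when (length a ≡ᵇ 0) X))
    ≡⟨ ∑-+ (sublists A) _ _ ⟩
  _ + ∑ (sublists A) (λ a → when (length a ≡ᵇ 1) (Cross a) + when (length a ≡ᵇ 0) X)
    ≡⟨ cong (∑ (sublists A) (λ a → when (length a ≡ᵇ 2) (F (without1 a))) +_)
            (trans (∑-+ (sublists A) _ _) (cong₂ _+_ (∑-sublists-length1 A Cross) (∑-sublists-length0 A (λ _ → X)))) ⟩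
  _ ∎
  where
  open ≡-Reasoning
  h : List (Subset (suc n)) → ℕ
  h b = when (length b ≡ᵇ 2) (F b)
  X = ∑ (sublists B) (λ b → when (length b ≡ᵇ 2) (F (with1 b)))
  Cross : List (Subset n) → ℕ
  Cross a = ∑ B (λ y → F (without1 a ++ with1 [ y ]))
  length-pre1 : ∀ b → length (with1 b) ≡ length b
  length-pre1 b = length-map (true ∷_) b
  byDeletionSize : ∀ a → ∑ (sublists B) (λ b → h (without1 a ++ with1 b))
    ≡ when (length a ≡ᵇ 2) (F (without1 a)) + (when (length a ≡ᵇ 1) (Cross a) + when (length a ≡ᵇ 0) X)
  byDeletionSize [] = ∑-cong (λ b → cong (λ m → when (m ≡ᵇ 2) (F (with1 b))) (length-pre1 b)) (sublists B)
  byDeletionSize (x ∷ []) = trans (∑-cong (λ b → cong (λ m → when (m ≡ᵇ 1) (F ((false ∷ x) ∷ with1 b))) (length-pre1 b)) (sublists B))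
                                 (trans (∑-sublists-length1 B (λ b → F ((false ∷ x) ∷ with1 b))) (sym (+-identityʳ _)))
  byDeletionSize (x ∷ x′ ∷ []) = trans (∑-cong (λ b → cong (λ m → when (m ≡ᵇ 0) (F ((false ∷ x) ∷ (false ∷ x′) ∷ with1 b))) (length-pre1 b)) (sublists B))
                                      (trans (∑-sublists-length0 B (λ b → F ((false ∷ x) ∷ (false ∷ x′) ∷ with1 b))) (sym (+-identityʳ _)))
  byDeletionSize (x ∷ x′ ∷ x″ ∷ a) = ∑-zero (sublists B) (λ _ _ → refl)

valid-fresh-without1 : ∀ m (a : List (Subset m)) → valid (suc m) fresh (without1 a) ≡ valid m negEnv a
valid-fresh-without1 m a = trans (cong (valid (suc m) fresh) (sym (++-identityʳ (without1 a)))) (trans (valid-split m fresh a []) (trans (cong (valid m negEnv a ∧_) (valid-[] m fresh (λ _ → refl))) (∧-identityʳ _)))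

valid-fresh-with1 : ∀ m (b : List (Subset m)) → valid (suc m) fresh (with1 b) ≡ valid m fresh b
valid-fresh-with1 m b = trans (valid-split m fresh [] b) (cong (_∧ valid m fresh b) (valid-[] m (after b) (safe-after b)))

-- The weight of a link b in count 3: the valid single sets of the deletion after it.
afterSingles : ∀ n W → List (Subset n) → ℕ
afterSingles n W b = when (valid n fresh b) (∑valid n (suc W) (after b) (sized 1))

pairThenSingle : ℕ → ℕ → ℕ
pairThenSingle n W = ∑ (sublists (subsets n W)) (λ b → when (length b ≡ᵇ 2) (afterSingles n W b))

deletedPairs-afterSingles : ∀ m W → 2 + W ≤ m →
  ∑ (sublists (subsets m (suc W))) (λ a → when (length a ≡ᵇ 2) (afterSingles (suc m) (suc W) (without1 a))) ≡ 1
deletedPairs-afterSingles m W le = begin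
  ∑ (sublists (subsets m (suc W))) (λ a → when (length a ≡ᵇ 2) (afterSingles (suc m) (suc W) (without1 a)))
    ≡⟨ ∑-cong (λ a → trans (cong (λ c → when (length a ≡ᵇ 2) (when c (g a))) (valid-fresh-without1 m a))
                           (when-comm (length a ≡ᵇ 2) (valid m negEnv a) (g a))) (sublists (subsets m (suc W))) ⟩
  ∑valid m (suc W) negEnv (λ a → when (length a ≡ᵇ 2) (g a))
    ≡⟨ ∑valid-negEnv-pairs m W g le ⟩
  g (top m (suc W) ∷ nextTop m (suc W) ∷ [])
    ≡⟨ singles-after-deletedPair m W le ⟩
  1 ∎
  where
  open ≡-Reasoning
  g : List (Subset m) → ℕ
  g a = ∑valid (suc m) (2 + W) (after (without1 a)) (sized 1)

single-then-cross : ∀ m W → 2 + W ≤ m →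
  ∑ (subsets (suc m) W) (λ y → when (valid (suc m) fresh [ y ])
    (∑ (subsets (suc m) (suc W)) (λ x → when (valid (suc m) (after [ y ]) [ x ]) (singles-posNegAt (suc m) (2 + W) x + 1))))
  ≡ 2 + W
single-then-cross m zero le = trans (∑-valid-fresh-single-zero m _)
  (trans (∑-valid-after-minus-top m 0 (λ x → singles-posNegAt (suc m) 2 x + 1) (≤-trans (s≤s z≤n) le))
         (cong (_+ 1) (singles-posNegAt-plusTop m 0 le)))
single-then-cross m (suc W) le = trans (∑-valid-fresh-single-suc m W _ W<m)
  (cong₂ _+_ (trans (∑-valid-after-minus-top m (suc W) g (≤-trans (n≤1+n _) le))
                    (cong (_+ 1) (singles-posNegAt-plusTop m (suc W) le)))
             (trans (∑-cong (λ y → cong (when (valid m fresh [ y ])) (plusLink y)) (subsets m W))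
                    (count-fresh-single m W W<m)))
  where
  W<m : W < m
  W<m = ≤-trans (n≤1+n _) (≤-trans (n≤1+n _) le)
  g : Subset (suc m) → ℕ
  g x = singles-posNegAt (suc m) (3 + W) x + 1
  plusLink : ∀ y → ∑ (subsets (suc m) (2 + W)) (λ x → when (valid (suc m) (after [ true ∷ y ]) [ x ]) (g x)) ≡ 1
  plusLink y = trans (∑-valid-after-plus m (suc W) y g (≤-trans (n≤1+n _) le))
                     (cong (_+ 1) (trans (cong (singles-posNegAt (suc m) (3 + W)) (sym (top-false∷ (≤-trans (n≤1+n _) le))))
                                         (singles-posNegAt-top (suc m) (suc W) (s≤s (≤-trans (n≤1+n _) le)))))

crossPairs-afterSingles : ∀ m W → 3 + W ≤ m →
  ∑ (subsets m (suc W)) (λ x → ∑ (subsets m W) (λ y → afterSingles (suc m) (suc W) ((false ∷ x) ∷ (true ∷ y) ∷ []))) ≡ 2 + W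
crossPairs-afterSingles (suc m) W le = begin
  ∑ (subsets (suc m) (suc W)) (λ x → ∑ (subsets (suc m) W) (λ y → afterSingles (suc (suc m)) (suc W) ((false ∷ x) ∷ (true ∷ y) ∷ [])))
    ≡⟨ ∑-cong-∈ (subsets (suc m) (suc W)) (λ x x∈ → ∑-cong (crossTerm x x∈) (subsets (suc m) W)) ⟩
  ∑ (subsets (suc m) (suc W)) (λ x → ∑ (subsets (suc m) W) (λ y → when (valid (suc m) fresh [ y ]) (G y x)))
    ≡⟨ ∑-comm (subsets (suc m) (suc W)) (subsets (suc m) W) (λ x y → when (valid (suc m) fresh [ y ]) (G y x)) ⟩
  ∑ (subsets (suc m) W) (λ y → ∑ (subsets (suc m) (suc W)) (λ x → when (valid (suc m) fresh [ y ]) (G y x)))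
    ≡⟨ ∑-cong (λ y → ∑-when (valid (suc m) fresh [ y ]) (subsets (suc m) (suc W)) (G y)) (subsets (suc m) W) ⟩
  ∑ (subsets (suc m) W) (λ y → when (valid (suc m) fresh [ y ]) (∑ (subsets (suc m) (suc W)) (G y)))
    ≡⟨ single-then-cross m W (≤-pred le) ⟩
  2 + W ∎
  where
  open ≡-Reasoning
  G : Subset (suc m) → Subset (suc m) → ℕ
  G y x = when (valid (suc m) (after [ y ]) [ x ]) (singles-posNegAt (suc m) (2 + W) x + 1)
  when-∧-+ : ∀ c d v → when (c ∧ d) (v + when c 1) ≡ when d (when c (v + 1))
  when-∧-+ true true v = refl
  when-∧-+ true false v = refl
  when-∧-+ false true v = refl
  when-∧-+ false false v = refl
  crossTerm : ∀ x → x ∈ subsets (suc m) (suc W) → ∀ y → afterSingles (suc (suc m)) (suc W) ((false ∷ x) ∷ (true ∷ y) ∷ []) ≡ when (valid (suc m) fresh [ y ]) (G y x)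
  crossTerm x x∈ y = trans (cong₂ when (valid-split (suc m) fresh [ x ] [ y ]) (singles-after-cross (suc m) W x y x∈ (≤-trans (n≤1+n _) le)))
                           (when-∧-+ (valid (suc m) (after [ y ]) [ x ]) (valid (suc m) fresh [ y ]) (singles-posNegAt (suc m) (2 + W) x))

linkedPairs-afterSingles : ∀ m W → suc W < m →
  ∑ (sublists (subsets m W)) (λ b → when (length b ≡ᵇ 2) (afterSingles (suc m) (suc W) (with1 b))) ≡ count 2 m W
linkedPairs-afterSingles m W lt = ∑-cong (λ b → trans (cong (when (length b ≡ᵇ 2)) (onLink b)) (when-comm (length b ≡ᵇ 2) (valid m fresh b) 1)) (sublists (subsets m W))
  where
  onLink : ∀ b → afterSingles (suc m) (suc W) (with1 b) ≡ when (valid m fresh b) 1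
  onLink b = trans (cong (λ c → when c (∑valid (suc m) (2 + W) (after (with1 b)) (sized 1))) (valid-fresh-with1 m b))
                   (cong (when (valid m fresh b)) (singles-after-linked m (suc W) b lt))

pairThenSingle-suc : ∀ m W → 3 + W ≤ m → pairThenSingle (suc m) (suc W) ≡ 1 + (2 + W) + count 2 m W
pairThenSingle-suc m W le = begin
  ∑ (sublists (without1 (subsets m (suc W)) ++ with1 (subsets m W))) (λ b → when (length b ≡ᵇ 2) (F b))
    ≡⟨ ∑-pairs-split (subsets m (suc W)) (subsets m W) F ⟩
  ∑ (sublists (subsets m (suc W))) (λ a → when (length a ≡ᵇ 2) (F (without1 a)))
    + (∑ (subsets m (suc W)) (λ x → ∑ (subsets m W) (λ y → F ((false ∷ x) ∷ (true ∷ y) ∷ [])))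
    + ∑ (sublists (subsets m W)) (λ b → when (length b ≡ᵇ 2) (F (with1 b))))
    ≡⟨ cong₂ _+_ (deletedPairs-afterSingles m W (≤-trans (n≤1+n _) le))
                 (cong₂ _+_ (crossPairs-afterSingles m W le) (linkedPairs-afterSingles m W (≤-trans (n≤1+n _) le))) ⟩
  1 + ((2 + W) + count 2 m W)
    ≡⟨ sym (+-assoc 1 (2 + W) _) ⟩
  1 + (2 + W) + count 2 m W ∎
  where
  open ≡-Reasoning
  F = afterSingles (suc m) (suc W)

-- Recurrences and closed forms

∑valid-sized0 : ∀ n W (σ : Subset n → Phase) → (∀ C → safe (σ C) ≡ true) → ∑valid n W σ (sized 0) ≡ 1
∑valid-sized0 n W σ sf = begin
  ∑valid n W σ (sized 0)                                                  ≡⟨ ∑-cong (λ a → when-comm (valid n σ a) (length a ≡ᵇ 0) 1) (sublists (subsets n W)) ⟩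
  ∑ (sublists (subsets n W)) (λ a → when (length a ≡ᵇ 0) (when (valid n σ a) 1)) ≡⟨ ∑-sublists-length0 (subsets n W) (λ a → when (valid n σ a) 1) ⟩
  when (valid n σ []) 1                                                    ≡⟨ cong (λ c → when c 1) (valid-[] n σ sf) ⟩
  1 ∎
  where open ≡-Reasoning

subsets-zero : ∀ n → subsets n 0 ≡ [ top n 0 ]
subsets-zero zero = refl
subsets-zero (suc n) rewrite subsets-zero n | top-false∷ {n} {0} z≤n = refl

count-empty-sets : ∀ p n → count (2 + p) n 0 ≡ 0
count-empty-sets p n rewrite subsets-zero n =
  cong₂ _+_ (when-zero (valid n fresh [ top n 0 ])) (cong (_+ 0) (when-zero (valid n fresh [])))

-- Splitting by the link b: with q sets in all, the deletion carries q - |b| of them.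
linkTerm : ∀ q n W → List (Subset n) → ℕ
linkTerm q n W b = when (valid n fresh b) (∑valid n (suc W) (after b) (λ a → sized q (without1 a ++ with1 b)))

linkTerm-over : ∀ q n W b → q < length b → linkTerm q n W b ≡ 0
linkTerm-over q n W b lt = trans (cong (when (valid n fresh b)) (∑valid-zero n (suc W) (after b) _ (λ a → cong (λ c → when c 1) (length-split-over q a b (over a)))))
                                 (when-zero (valid n fresh b))
  where
  over : ∀ (a : List (Subset n)) → q < length a + length b
  over a = ≤-trans lt (m≤n+m (length b) (length a))

linkTerm-length : ∀ n W i j b → when (length b ≡ᵇ i) (linkTerm (i + j) n W b)
                              ≡ when (length b ≡ᵇ i) (when (valid n fresh b) (∑valid n (suc W) (after b) (sized j)))
linkTerm-length n W i j b with length b ≡ᵇ i in e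
... | false = refl
... | true rewrite sym (≡ᵇ⇒≡ (length b) i (subst T (sym e) _)) =
  cong (when (valid n fresh b)) (∑valid-cong-weight n (suc W) (after b) (λ a → sized-split j a b))

linkTerm-[] : ∀ q n W → linkTerm q n W [] ≡ ∑valid n (suc W) negEnv (sized q)
linkTerm-[] q n W = trans (cong (λ c → when c (∑valid n (suc W) negEnv (λ a → sized q (without1 a ++ [])))) (valid-[] n fresh (λ _ → refl)))
                     (∑valid-cong-weight n (suc W) negEnv (λ a → sized-split q a []))

linkTerm-single : ∀ q n W y → linkTerm (suc q) n W [ y ] ≡ when (valid n fresh [ y ]) (∑valid n (suc W) (after [ y ]) (sized q))
linkTerm-single q n W y = cong (when (valid n fresh [ y ])) (∑valid-cong-weight n (suc W) (after [ y ]) (λ a → sized-split q a [ y ]))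

∑-linkTerm-full : ∀ q n W → ∑ (sublists (subsets n W)) (λ b → when (length b ≡ᵇ q) (linkTerm (q + 0) n W b)) ≡ count q n W
∑-linkTerm-full q n W = ∑-cong (λ b → trans (linkTerm-length n W q 0 b) (trans (cong (when (length b ≡ᵇ q)) (cong (when (valid n fresh b)) (∑valid-sized0 n (suc W) (after b) (safe-after b))))
                                                                    (when-comm (length b ≡ᵇ q) (valid n fresh b) 1)))
                         (sublists (subsets n W))

count-2-suc : ∀ n W → 2 + W ≤ n → count 2 (suc n) (suc W) ≡ 1 + (suc W + count 2 n W)
count-2-suc n W le = begin
  count 2 (suc n) (suc W)
    ≡⟨ ∑valid-suc n W fresh (sized 2) ⟩
  ∑ bs L
    ≡⟨ ∑-cong byLength bs ⟩
  ∑ bs (λ b → when (length b ≡ᵇ 0) (L b) + (when (length b ≡ᵇ 1) (L b) + when (length b ≡ᵇ 2) (L b)))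
    ≡⟨ trans (∑-+ bs _ _) (cong (∑ bs (λ b → when (length b ≡ᵇ 0) (L b)) +_) (∑-+ bs _ _)) ⟩
  ∑ bs (λ b → when (length b ≡ᵇ 0) (L b)) + (∑ bs (λ b → when (length b ≡ᵇ 1) (L b)) + ∑ bs (λ b → when (length b ≡ᵇ 2) (L b)))
    ≡⟨ cong₂ _+_ (trans (∑-sublists-length0 (subsets n W) L) (trans (linkTerm-[] 2 n W) (count-negEnv-2 n W le)))
                 (cong₂ _+_ (trans (∑-sublists-length1 (subsets n W) L) (trans (∑-cong (linkTerm-single 1 n W) (subsets n W)) (∑-single-then-single n W le))) (∑-linkTerm-full 2 n W)) ⟩
  1 + (suc W + count 2 n W) ∎
  where
  open ≡-Reasoning
  bs = sublists (subsets n W)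
  L = linkTerm 2 n W
  byLength : ∀ b → L b ≡ when (length b ≡ᵇ 0) (L b) + (when (length b ≡ᵇ 1) (L b) + when (length b ≡ᵇ 2) (L b))
  byLength [] = sym (+-identityʳ _)
  byLength (_ ∷ []) = sym (+-identityʳ _)
  byLength (_ ∷ _ ∷ []) = refl
  byLength b@(_ ∷ _ ∷ _ ∷ _) = linkTerm-over 2 n W b (s≤s (s≤s (s≤s z≤n)))

count-3-suc : ∀ n W → 3 + W ≤ n → count 3 (suc n) (suc W) ≡ suc (1 ⊓ W) + (suc W + (pairThenSingle n W + count 3 n W))
count-3-suc n W le = begin
  count 3 (suc n) (suc W)
    ≡⟨ ∑valid-suc n W fresh (sized 3) ⟩
  ∑ bs L
    ≡⟨ ∑-cong byLength bs ⟩
  ∑ bs (λ b → L₀ b + (L₁ b + (L₂ b + L₃ b)))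
    ≡⟨ trans (∑-+ bs _ _) (cong (∑ bs L₀ +_) (trans (∑-+ bs _ _) (cong (∑ bs L₁ +_) (∑-+ bs _ _)))) ⟩
  ∑ bs L₀ + (∑ bs L₁ + (∑ bs L₂ + ∑ bs L₃))
    ≡⟨ cong₂ _+_ (trans (∑-sublists-length0 (subsets n W) L) (trans (linkTerm-[] 3 n W) (count-negEnv-3 n W le)))
                 (cong₂ _+_ (trans (∑-sublists-length1 (subsets n W) L) (trans (∑-cong (linkTerm-single 2 n W) (subsets n W)) (∑-single-then-pair n W le)))
                            (cong₂ _+_ (∑-cong (linkTerm-length n W 2 1) bs) (∑-linkTerm-full 3 n W))) ⟩
  suc (1 ⊓ W) + (suc W + (pairThenSingle n W + count 3 n W)) ∎
  where
  open ≡-Reasoning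
  bs = sublists (subsets n W)
  L = linkTerm 3 n W
  L₀ L₁ L₂ L₃ : List (Subset n) → ℕ
  L₀ b = when (length b ≡ᵇ 0) (L b)
  L₁ b = when (length b ≡ᵇ 1) (L b)
  L₂ b = when (length b ≡ᵇ 2) (L b)
  L₃ b = when (length b ≡ᵇ 3) (L b)
  byLength : ∀ b → L b ≡ L₀ b + (L₁ b + (L₂ b + L₃ b))
  byLength [] = sym (+-identityʳ _)
  byLength (_ ∷ []) = sym (+-identityʳ _)
  byLength (_ ∷ _ ∷ []) = sym (+-identityʳ _)
  byLength (_ ∷ _ ∷ _ ∷ []) = refl
  byLength b@(_ ∷ _ ∷ _ ∷ _ ∷ _) = linkTerm-over 3 n W b (s≤s (s≤s (s≤s (s≤s z≤n))))

pairThenSingle-zero : ∀ n → pairThenSingle n 0 ≡ 0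
pairThenSingle-zero n rewrite subsets-zero n = refl

expand₂ : ∀ d X → 2 * (1 + (suc d + X)) ≡ (4 + 2 * d) + 2 * X
expand₂ = solve 2 (λ d X → con 2 :* (con 1 :+ ((con 1 :+ d) :+ X)) := (con 4 :+ con 2 :* d) :+ con 2 :* X) refl

collect₂ : ∀ d → (4 + 2 * d) + (d ^ 2 + 3 * d) ≡ suc d ^ 2 + 3 * suc d
collect₂ = solve 1 (λ d → (con 4 :+ con 2 :* d) :+ (d :^ 2 :+ con 3 :* d) := (con 1 :+ d) :^ 2 :+ con 3 :* (con 1 :+ d)) refl

expand₃ : ∀ d Y Z → 6 * (2 + (2 + d + ((1 + (2 + d) + Y) + Z))) + 12 ≡ (42 + 12 * d) + 3 * (2 * Y) + (6 * Z + 12)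
expand₃ = solve 3 (λ d Y Z → con 6 :* (con 2 :+ ((con 2 :+ d) :+ ((con 1 :+ (con 2 :+ d) :+ Y) :+ Z))) :+ con 12
                           := (con 42 :+ con 12 :* d) :+ con 3 :* (con 2 :* Y) :+ (con 6 :* Z :+ con 12)) refl

collect₃ : ∀ d → (42 + 12 * d) + 3 * (d ^ 2 + 3 * d) + (suc d ^ 3 + 6 * suc d ^ 2 + 17 * suc d)
               ≡ suc (suc d) ^ 3 + 6 * suc (suc d) ^ 2 + 17 * suc (suc d)
collect₃ = solve 1 (λ d → (con 42 :+ con 12 :* d) :+ con 3 :* (d :^ 2 :+ con 3 :* d)
                              :+ ((con 1 :+ d) :^ 3 :+ con 6 :* (con 1 :+ d) :^ 2 :+ con 17 :* (con 1 :+ d))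
                         := (con 2 :+ d) :^ 3 :+ con 6 :* (con 2 :+ d) :^ 2 :+ con 17 :* (con 2 :+ d)) refl

count-2-closed : ∀ d n → 2 + d ≤ n → 2 * count 2 n d ≡ d ^ 2 + 3 * d
count-2-closed zero n le = cong (2 *_) (count-empty-sets 0 n)
count-2-closed (suc d) (suc n) (s≤s le) = begin
  2 * count 2 (suc n) (suc d)          ≡⟨ cong (2 *_) (count-2-suc n d le) ⟩
  2 * (1 + (suc d + count 2 n d))      ≡⟨ expand₂ d (count 2 n d) ⟩
  (4 + 2 * d) + 2 * count 2 n d        ≡⟨ cong ((4 + 2 * d) +_) (count-2-closed d n le) ⟩
  (4 + 2 * d) + (d ^ 2 + 3 * d)        ≡⟨ collect₂ d ⟩
  suc d ^ 2 + 3 * suc d ∎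
  where open ≡-Reasoning

count-3-closed : ∀ d n → 4 + d ≤ n → 6 * count 3 n (suc d) + 12 ≡ suc d ^ 3 + 6 * suc d ^ 2 + 17 * suc d
count-3-closed zero (suc n) (s≤s le) rewrite count-3-suc n 0 le | pairThenSingle-zero n | count-empty-sets 1 n = refl
count-3-closed (suc d) (suc (suc m)) (s≤s le@(s≤s le′)) = begin
  6 * count 3 (suc (suc m)) (2 + d) + 12
    ≡⟨ cong (λ t → 6 * t + 12) (trans (count-3-suc (suc m) (suc d) le) (cong (λ t → 2 + (2 + d + (t + Z))) (pairThenSingle-suc m d le′))) ⟩
  6 * (2 + (2 + d + ((1 + (2 + d) + Y) + Z))) + 12
    ≡⟨ expand₃ d Y Z ⟩
  (42 + 12 * d) + 3 * (2 * Y) + (6 * Z + 12)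
    ≡⟨ cong₂ (λ a b → (42 + 12 * d) + 3 * a + b) (count-2-closed d m (≤-trans (n≤1+n _) le′)) (count-3-closed d (suc m) le) ⟩
  (42 + 12 * d) + 3 * (d ^ 2 + 3 * d) + (suc d ^ 3 + 6 * suc d ^ 2 + 17 * suc d)
    ≡⟨ collect₃ d ⟩
  suc (suc d) ^ 3 + 6 * suc (suc d) ^ 2 + 17 * suc (suc d) ∎
  where
  open ≡-Reasoning
  Y = count 2 m d
  Z = count 3 (suc m) (suc d)

lemma24 : (d : ℕ) → 1 ≤ d →
    ((n : ℕ) → 2 + d ≤ n → 2 * coSigCount n d 2 ≡ d ^ 2 + 3 * d)
    × ((n : ℕ) → 3 + d ≤ n → 6 * coSigCount n d 3 + 12 ≡ d ^ 3 + 6 * d ^ 2 + 17 * d)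
lemma24 (suc d) _ =
  (λ n le → trans (cong (2 *_) (coSigCount≡count n d 2 (≤-trans (m≤n+m (suc d) 2) le))) (count-2-closed (suc d) n le)) ,
  (λ n le → trans (cong (λ t → 6 * t + 12) (coSigCount≡count n d 3 (≤-trans (m≤n+m (suc d) 3) le))) (count-3-closed d n le))
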